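{- For all $k\ge 2$, $$\sum_{n\ge0}\frac{t^n}{[n]_{p,q}!}\sum_{\substack{(\sigma,w)\in C_k\wr S_n\\ \mathrm{ris}(\sigma,w)=0}}q^{\mathrm{inv}(\sigma)}p^{\mathrm{coinv}(\sigma)}r^{\|w\|}=\frac{1}{1+\sum_{n\ge1}\frac{p^{\binom n2}(-t)^n}{[n]_{p,q}!}\begin{bmatrix} n+k-1\\ n\end{bmatrix}_r}.$$
   Context: $C_k\wr S_n$ is identified with the set of pairs $(\sigma,w)$, $\sigma\in S_n$, $w=w_1\cdots w_n\in\{0,\dots,k-1\}^n$ (one empty element for $n=0$). $\mathrm{ris}(\sigma,w)=|\{i\le n-1:\sigma_i<\sigma_{i+1},\ w_i\le w_{i+1}\}|$. $\mathrm{inv}(\sigma)=|\{a<b:\sigma_a>\sigma_b\}|$, $\mathrm{coinv}(\sigma)=|\{a<b:\sigma_a<\sigma_b\}|$, $\|w\|=w_1+\cdots+w_n$. $[n]_{p,q}=p^{n-1}+p^{n-2}q+\cdots+q^{n-1}$, $[n]_{p,q}!=[n]_{p,q}\cdots[1]_{p,q}$; $[n]_r=1+r+\cdots+r^{n-1}$, $[n]_r!=[n]_r\cdots[1]_r$, $\begin{bmatrix} a\\ b\end{bmatrix}_r=\frac{[a]_r!}{[b]_r![a-b]_r!}$. -}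

module Defs where

open import Level using (Level)
open import Data.Bool using (Bool; true; false; if_then_else_; _∧_)
open import Data.Nat as ℕ using (ℕ; zero; suc; _∸_; _<?_; _≤?_)
open import Data.Nat.Combinatorics using (_C_)
open import Data.Fin using (Fin; toℕ)
open import Data.List using (List; []; _∷_; map; concatMap; filter; length; foldr; upTo; allFin; zip)
open import Data.Bool.ListAction using (any)
open import Data.Nat.ListAction using (sum)
open import Data.Vec using (Vec; toList) renaming ([] to []ᵥ; _∷_ to _∷ᵥ_)
open import Data.Product using (_×_; _,_)
open import Relation.Nullary.Decidable using (⌊_⌋)
open import Algebra.Bundles using (CommutativeRing)

words : (m n : ℕ) → List (Vec (Fin m) n)
words m zero    = []ᵥ ∷ []
words m (suc n) = concatMap (λ x → map (x ∷ᵥ_) (words m n)) (allFin m)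

distinct : List ℕ → Bool
distinct []       = true
distinct (x ∷ xs) = (if any (λ y → ⌊ x ℕ.≟ y ⌋) xs then false else true) ∧ distinct xs

-- S_n: permutations of {1..n} written in one-line notation, realised as the
-- words of length n over Fin n (letters 0..n-1) with pairwise distinct letters
perms : (n : ℕ) → List (Vec (Fin n) n)
perms n = filter (λ σ → distinct (map toℕ (toList σ)) Data.Bool.≟ true) (words n n)

inv : List ℕ → ℕ
inv []       = 0
inv (x ∷ xs) = length (filter (λ y → y <? x) xs) ℕ.+ inv xs

coinv : List ℕ → ℕ
coinv []       = 0
coinv (x ∷ xs) = length (filter (λ y → x <? y) xs) ℕ.+ coinv xs

ris : List (ℕ × ℕ) → ℕ
ris []                             = 0
ris (_ ∷ [])                       = 0
ris ((a , u) ∷ (b , v) ∷ rest) =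
  (if ⌊ a <? b ⌋ ∧ ⌊ u ≤? v ⌋ then 1 else 0) ℕ.+ ris ((b , v) ∷ rest)

norm : List ℕ → ℕ
norm = sum

module Gen {c ℓ : Level} (R : CommutativeRing c ℓ) where
  open CommutativeRing R

  pow : Carrier → ℕ → Carrier
  pow x zero    = 1#
  pow x (suc n) = x * pow x n

  Σ : List Carrier → Carrier
  Σ = foldr _+_ 0#

  pqInt : Carrier → Carrier → ℕ → Carrier
  pqInt p q n = Σ (map (λ i → pow p (n ∸ 1 ∸ i) * pow q i) (upTo n))

  pqFact : Carrier → Carrier → ℕ → Carrier
  pqFact p q zero    = 1#
  pqFact p q (suc n) = pqInt p q (suc n) * pqFact p q n

  rInt : Carrier → ℕ → Carrier
  rInt r n = Σ (map (pow r) (upTo n))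

  rFact : Carrier → ℕ → Carrier
  rFact r zero    = 1#
  rFact r (suc n) = rInt r (suc n) * rFact r n

  -- [a choose b]_r = [a]_r! / ([b]_r! [a-b]_r!), given inverses  ir m = ([m]_r!)^{-1}
  rBinom : Carrier → (ℕ → Carrier) → ℕ → ℕ → Carrier
  rBinom r ir a b = rFact r a * (ir b * ir (a ∸ b))

  risZeroSum : ℕ → Carrier → Carrier → Carrier → ℕ → Carrier
  risZeroSum k p q r n =
    Σ (concatMap (λ σ → map (λ w →
         let σl = map toℕ (toList σ)
             wl = map toℕ (toList w) in
         if ⌊ ris (zip σl wl) ℕ.≟ 0 ⌋
           then pow q (inv σl) * pow p (coinv σl) * pow r (norm wl)
           else 0#)
       (words k n)) (perms n))

  -- coefficient of t^n of the left-hand side  (ipq m = ([m]_{p,q}!)^{-1})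
  lhsCoeff : ℕ → Carrier → Carrier → Carrier → (ℕ → Carrier) → ℕ → Carrier
  lhsCoeff k p q r ipq n = ipq n * risZeroSum k p q r n

  -- coefficient of t^n of the denominator  1 + Σ_{n≥1} p^{C(n,2)} (-t)^n / [n]_{p,q}! [n+k-1 choose n]_r
  denCoeff : ℕ → Carrier → Carrier → Carrier → (ℕ → Carrier) → (ℕ → Carrier) → ℕ → Carrier
  denCoeff k p q r ipq ir zero    = 1#
  denCoeff k p q r ipq ir (suc m) =
    let n = suc m in
    pow p (n C 2) * pow (- 1#) n * ipq n * rBinom r ir (n ℕ.+ k ∸ 1) n

  -- coefficient of t^N in the product of two formal power series in t
  conv : (ℕ → Carrier) → (ℕ → Carrier) → ℕ → Carrier
  conv f g N = Σ (map (λ m → f m * g (N ∸ m)) (upTo (suc N)))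

  one : ℕ → Carrier
  one zero    = 1#
  one (suc _) = 0#

module Submission where

-- Encode σ ∈ S_n by its Lehmer code: c_i is the rank of σ_i among the letters not used before
-- position i, so c_i < n − i, inv σ = Σ c_i, coinv σ = Σ (n − 1 − i − c_i), and σ_i < σ_{i+1} iff
-- c_i ≤ c_{i+1}. Hence ris(σ,w) = 0 says that no two adjacent letter–colour pairs (c_i, w_i),
-- (c_{i+1}, w_{i+1}) weakly increase in both coordinates. For any relation on the letters of a nonempty
-- word u, Σ_j (−1)^j [u_1…u_j rises throughout] [u_{j+1}… never rises] = 0 by a sign-reversing
-- cancellation. Summed over all codes and colourings of length N, a rising prefix of length j is a pair
-- of weakly increasing chains, weighted p^(j choose 2) [N choose j]_{p,q} [j+k−1 choose j]_r, and the
-- rest is a ris-free word of length N − j. After dividing by [N]_{p,q}! this alternating sum is the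
-- coefficient of t^N in the left-hand side times the denominator, which therefore is 1.

open import Defs
open import Level using (Level)
open import Data.Nat using (ℕ; _≤_)
open import Algebra.Bundles using (CommutativeRing)

open import Data.Bool using (Bool; true; false; _∧_; not; if_then_else_)
import Data.Bool as Bool
open import Data.Bool.Properties using (∧-identityʳ)
open import Data.Nat as ℕ using (zero; suc; _∸_; _<_; _>_; _≤ᵇ_; _≤?_; _≟_; z≤n; s≤s)
import Data.Nat.Properties as ℕ
open import Data.Nat.ListAction using (sum)
open import Data.Nat.Combinatorics using (_C_)
open import Data.Fin using (Fin; toℕ)
open import Data.Vec using (Vec; toList) renaming (_∷_ to _∷ᵥ_)
open import Data.Product using (_×_; _,_; proj₁; proj₂)
open import Data.List using (List; []; _∷_; _++_; map; applyUpTo; length; take; drop; concatMap; filter; replicate; tabulate; allFin; downFrom; zip)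
open import Data.List.Properties using (map-concatMap; map-∘; map-tabulate; length-map; length-replicate; length-applyDownFrom; map-replicate)
open import Data.List.Relation.Unary.All using (All; []; _∷_)
open import Data.List.Relation.Unary.AllPairs using (AllPairs; []; _∷_)
open import Data.List.Relation.Binary.Pointwise using (Pointwise; []; _∷_)
open import Relation.Nullary using (does; proof)
open import Relation.Nullary.Reflects using (ofʸ)
open import Relation.Nullary.Decidable using (⌊_⌋; dec-true; dec-false; isYes≗does)
open import Relation.Binary.PropositionalEquality as ≡ using (_≡_)

module Combinatorics where
  open import Data.Bool using (Bool; true; false; _∧_; _∨_; not; if_then_else_)
  open import Data.Bool.ListAction using (any)
  open import Data.Bool.Properties using (∨-zeroʳ; ∧-zeroʳ)
  open import Data.Nat using (zero; suc; _+_; _*_; _∸_; _<_; _>_; _≤_; _≤ᵇ_; _≟_; _<?_; _≤?_; z≤n; s≤s; s≤s⁻¹)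
  open import Data.Nat.Properties
  open import Data.Nat.ListAction using (sum)
  open import Data.Nat.Combinatorics using (_C_; nC1≡n; nCk+nC[k+1]≡[n+1]C[k+1])
  open import Data.List using (List; []; _∷_; _++_; length; filter; replicate; zip; map; downFrom; take; drop)
  open import Data.List.Properties using (filter-accept; filter-reject; filter-all; filter-none)
  open import Data.List.Relation.Unary.All as All using (All; []; _∷_)
  open import Data.List.Relation.Unary.AllPairs using (AllPairs; []; _∷_)
  open import Data.List.Relation.Binary.Pointwise using (Pointwise; []; _∷_)
  open import Data.List.Relation.Binary.Permutation.Propositional as ↭ using (_↭_)
  open import Data.List.Relation.Binary.Permutation.Propositional.Properties using (↭-length; filter-↭)
  open import Data.Product using (_×_; _,_; proj₁; proj₂)
  open import Data.Sum using (inj₁; inj₂)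
  open import Data.Empty using (⊥-elim)
  open import Function using (mk⇔)
  open import Relation.Nullary using (does; proof; ¬_)
  open import Relation.Nullary.Reflects using (ofʸ; ofⁿ)
  open import Relation.Nullary.Decidable using (⌊_⌋; dec-true; dec-false; does-⇔; isYes≗does)
  open import Relation.Unary using (Decidable)
  open import Relation.Binary using (Rel)
  open import Relation.Binary.PropositionalEquality

  linkedFrom : ∀ {a} {A : Set a} → (A → A → Bool) → A → List A → Bool
  linkedFrom R x []      = true
  linkedFrom R x (y ∷ l) = R x y ∧ linkedFrom R y l

  linked : ∀ {a} {A : Set a} → (A → A → Bool) → List A → Bool
  linked R []      = true
  linked R (x ∷ l) = linkedFrom R x l

  nth : List ℕ → ℕ → ℕ
  nth []      _       = 0
  nth (x ∷ S) zero    = x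
  nth (x ∷ S) (suc i) = nth S i

  member : ℕ → List ℕ → Bool
  member x []      = false
  member x (y ∷ S) = does (x ≟ y) ∨ member x S

  delete : ℕ → List ℕ → List ℕ
  delete x []      = []
  delete x (y ∷ S) = if does (x ≟ y) then S else y ∷ delete x S

  Ascending : List ℕ → Set
  Ascending = AllPairs _<_

  All-delete : ∀ {p} {P : ℕ → Set p} x {S} → All P S → All P (delete x S)
  All-delete x {[]}    []        = []
  All-delete x {y ∷ S} (py ∷ ps) with does (x ≟ y)
  ... | true  = ps
  ... | false = py ∷ All-delete x ps

  AllPairs-delete : ∀ {r} {R : Rel ℕ r} x {S} → AllPairs R S → AllPairs R (delete x S)
  AllPairs-delete x {[]}    []        = []
  AllPairs-delete x {y ∷ S} (ry ∷ rs) with does (x ≟ y)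
  ... | true  = rs
  ... | false = All-delete x ry ∷ AllPairs-delete x rs

  All-nth : ∀ {p} {P : ℕ → Set p} {S} i → All P S → i < length S → P (nth S i)
  All-nth zero    (px ∷ _)  _         = px
  All-nth (suc i) (_ ∷ pxs) (s≤s i<n) = All-nth i pxs i<n

  member-nth : ∀ S i → i < length S → member (nth S i) S ≡ true
  member-nth (x ∷ S) zero    _         rewrite dec-true (x ≟ x) refl = refl
  member-nth (x ∷ S) (suc i) (s≤s i<n) rewrite member-nth S i i<n = ∨-zeroʳ _

  member-lowerBound : ∀ {x} S → All (x <_) S → member x S ≡ false
  member-lowerBound []      []          = refl
  member-lowerBound (y ∷ S) (x<y ∷ x<S) rewrite dec-false (_ ≟ y) (<⇒≢ x<y) = member-lowerBound S x<S

  length-delete : ∀ x S → member x S ≡ true → suc (length (delete x S)) ≡ length S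
  length-delete x (y ∷ S) x∈S with does (x ≟ y)
  ... | true  = refl
  ... | false = cong suc (length-delete x S x∈S)

  delete-↭ : ∀ x S → member x S ≡ true → x ∷ delete x S ↭ S
  delete-↭ x (y ∷ S) x∈S with does (x ≟ y) | proof (x ≟ y)
  ... | true  | ofʸ refl = ↭.refl
  ... | false | ofⁿ _    = ↭.trans (↭.swap x y ↭.refl) (↭.prep y (delete-↭ x S x∈S))

  nth-member : ∀ S {m c} → length S ≡ m → c < m → member (nth S c) S ≡ true
  nth-member S len c<m = member-nth S _ (subst (_ <_) (sym len) c<m)

  length-delete-nth : ∀ S {m c} → length S ≡ suc m → c < suc m → length (delete (nth S c) S) ≡ m
  length-delete-nth S len c<m = suc-injective (trans (length-delete _ S (nth-member S len c<m)) len)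

  -- Lehmer codes

  codeBounds : ℕ → List ℕ
  codeBounds zero    = []
  codeBounds (suc m) = suc m ∷ codeBounds m

  IsCode : ℕ → List ℕ → Set
  IsCode m = Pointwise _>_ (codeBounds m)

  -- c_i is the rank of the i-th letter among the letters of S not used before it.
  decode : List ℕ → List ℕ → List ℕ
  decode S []       = []
  decode S (c ∷ cs) = nth S c ∷ decode (delete (nth S c) S) cs

  coinvCode : List ℕ → List ℕ → ℕ
  coinvCode (b ∷ bs) (c ∷ cs) = (b ∸ 1 ∸ c) + coinvCode bs cs
  coinvCode _        _        = 0

  decode-↭ : ∀ m S cs → length S ≡ m → IsCode m cs → decode S cs ↭ S
  decode-↭ zero    []      []       _   []           = ↭.refl
  decode-↭ (suc m) S       (c ∷ cs) len (c<m ∷ code) =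
    ↭.trans (↭.prep _ (decode-↭ m _ cs (length-delete-nth S len c<m) code)) (delete-↭ _ S (nth-member S len c<m))

  count : ∀ {p} {P : ℕ → Set p} → Decidable P → List ℕ → ℕ
  count P? l = length (filter P? l)

  module _ {p} {P : ℕ → Set p} (P? : Decidable P) where

    count-↭ : ∀ {xs ys} → xs ↭ ys → count P? xs ≡ count P? ys
    count-↭ xs↭ys = ↭-length (filter-↭ P? xs↭ys)

    count-delete : ∀ {x} S → ¬ P x → member x S ≡ true → count P? (delete x S) ≡ count P? S
    count-delete S ¬px x∈S = trans (cong length (sym (filter-reject P? ¬px))) (count-↭ (delete-↭ _ S x∈S))

    count-decode-delete : ∀ m S cs {c} → length S ≡ suc m → c < suc m → IsCode m cs → ¬ P (nth S c) →
                          count P? (decode (delete (nth S c) S) cs) ≡ count P? S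
    count-decode-delete m S cs len c<m code ¬px =
      trans (count-↭ (decode-↭ m _ cs (length-delete-nth S len c<m) code)) (count-delete S ¬px (nth-member S len c<m))

  count-<-nth : ∀ S c → Ascending S → c < length S → count (_<? nth S c) S ≡ c
  count-<-nth (s ∷ S) zero    (s<S ∷ _) _ =
    cong length (trans (filter-reject (_<? s) (<-irrefl refl)) (filter-none (_<? s) (All.map <⇒≯ s<S)))
  count-<-nth (s ∷ S) (suc c) (s<S ∷ asc) (s≤s c<n) =
    trans (cong length (filter-accept (_<? nth S c) (All-nth c s<S c<n))) (cong suc (count-<-nth S c asc c<n))

  count->-nth : ∀ S c → Ascending S → c < length S → count (nth S c <?_) S ≡ length S ∸ suc c
  count->-nth (s ∷ S) zero    (s<S ∷ _) _ =
    cong length (trans (filter-reject (s <?_) (<-irrefl refl)) (filter-all (s <?_) s<S))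
  count->-nth (s ∷ S) (suc c) (s<S ∷ asc) (s≤s c<n) =
    trans (cong length (filter-reject (nth S c <?_) (<⇒≯ (All-nth c s<S c<n)))) (count->-nth S c asc c<n)

  inv-decode : ∀ m S cs → Ascending S → length S ≡ m → IsCode m cs → inv (decode S cs) ≡ sum cs
  inv-decode zero    _ []       _   _   []           = refl
  inv-decode (suc m) S (c ∷ cs) asc len (c<m ∷ code) =
    cong₂ _+_ (trans (count-decode-delete (_<? nth S c) m S cs len c<m code (<-irrefl refl))
                     (count-<-nth S c asc (subst (c <_) (sym len) c<m)))
              (inv-decode m _ cs (AllPairs-delete _ asc) (length-delete-nth S len c<m) code)

  coinv-decode : ∀ m S cs → Ascending S → length S ≡ m → IsCode m cs → coinv (decode S cs) ≡ coinvCode (codeBounds m) cs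
  coinv-decode zero    _ []       _   _   []           = refl
  coinv-decode (suc m) S (c ∷ cs) asc len (c<m ∷ code) =
    cong₂ _+_ (trans (count-decode-delete (nth S c <?_) m S cs len c<m code (<-irrefl refl))
                     (trans (count->-nth S c asc (subst (c <_) (sym len) c<m)) (cong (_∸ suc c) len)))
              (coinv-decode m _ cs (AllPairs-delete _ asc) (length-delete-nth S len c<m) code)

  ≤ᵇ-suc : ∀ a b → (suc a ≤ᵇ suc b) ≡ (a ≤ᵇ b)
  ≤ᵇ-suc a b = does-⇔ (mk⇔ s≤s⁻¹ s≤s) (suc a ≤? suc b) (a ≤? b)

  nth-delete-< : ∀ S a b → Ascending S → a < length S → suc b < length S →
                 does (nth S a <? nth (delete (nth S a) S) b) ≡ (a ≤ᵇ b)
  nth-delete-< (s ∷ S) zero    b (s<S ∷ _) _ (s≤s b<n)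
    rewrite dec-true (s ≟ s) refl = dec-true (s <? nth S b) (All-nth b s<S b<n)
  nth-delete-< (s ∷ S) (suc a) zero (s<S ∷ _) (s≤s a<n) _
    rewrite dec-false (nth S a ≟ s) (>⇒≢ (All-nth a s<S a<n)) = dec-false (nth S a <? s) (<⇒≯ (All-nth a s<S a<n))
  nth-delete-< (s ∷ S) (suc a) (suc b) (s<S ∷ asc) (s≤s a<n) (s≤s b<n)
    rewrite dec-false (nth S a ≟ s) (>⇒≢ (All-nth a s<S a<n)) = trans (nth-delete-< S a b asc a<n b<n) (sym (≤ᵇ-suc a b))

  rise : ℕ × ℕ → ℕ × ℕ → Bool
  rise (c , w) (c' , w') = (c ≤ᵇ c') ∧ (w ≤ᵇ w')

  descent : ℕ × ℕ → ℕ × ℕ → Bool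
  descent x y = not (rise x y)

  ris≡0-∷ : ∀ a u b v rest → does (ris ((a , u) ∷ (b , v) ∷ rest) ≟ 0) ≡
            not (does (a <? b) ∧ does (u ≤? v)) ∧ does (ris ((b , v) ∷ rest) ≟ 0)
  ris≡0-∷ a u b v rest rewrite isYes≗does (a <? b) | isYes≗does (u ≤? v) with does (a <? b) ∧ does (u ≤? v)
  ... | true  = refl
  ... | false = refl

  ris-decode : ∀ m S cs ws → Ascending S → length S ≡ m → IsCode m cs →
               does (ris (zip (decode S cs) ws) ≟ 0) ≡ linked descent (zip cs ws)
  ris-decode m S []           ws             _   _   _ = refl
  ris-decode m S (c ∷ [])     []             _   _   _ = refl
  ris-decode m S (c ∷ [])     (w ∷ ws)       _   _   _ = refl
  ris-decode m S (c ∷ _ ∷ _)  []             _   _   _ = refl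
  ris-decode m S (c ∷ _ ∷ _)  (w ∷ [])       _   _   _ = refl
  ris-decode (suc (suc m)) S (c ∷ c₁ ∷ cs) (w ∷ w₁ ∷ ws) asc len (c< ∷ c₁< ∷ code) =
    trans (ris≡0-∷ (nth S c) w (nth S' c₁) w₁ (zip (decode (delete (nth S' c₁) S') cs) ws))
          (cong₂ (λ x y → not (x ∧ (w ≤ᵇ w₁)) ∧ y) adjacent
                 (ris-decode (suc m) S' (c₁ ∷ cs) (w₁ ∷ ws) (AllPairs-delete _ asc) (length-delete-nth S len c<) (c₁< ∷ code)))
    where
    S' = delete (nth S c) S
    adjacent : does (nth S c <? nth S' c₁) ≡ (c ≤ᵇ c₁)
    adjacent = nth-delete-< S c c₁ asc (subst (c <_) (sym len) c<) (subst (suc c₁ <_) (sym len) (s≤s c₁<))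

  _⊆ᵇ_ : List ℕ → List ℕ → Bool
  []      ⊆ᵇ S = true
  (y ∷ σ) ⊆ᵇ S = member y S ∧ (σ ⊆ᵇ S)

  ≟-sym : ∀ x y → does (x ≟ y) ≡ does (y ≟ x)
  ≟-sym x y = does-⇔ (mk⇔ sym sym) (x ≟ y) (y ≟ x)

  member-delete : ∀ x y S → Ascending S → member x S ≡ true → member y (delete x S) ≡ not (does (y ≟ x)) ∧ member y S
  member-delete x y (s ∷ S) (s<S ∷ asc) x∈S with does (x ≟ s) | proof (x ≟ s)
  ... | true | ofʸ refl with does (y ≟ x) | proof (y ≟ x)
  ...   | true  | ofʸ refl = member-lowerBound S s<S
  ...   | false | ofⁿ _    = refl
  member-delete x y (s ∷ S) (_ ∷ asc) x∈S | false | ofⁿ x≢s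
    rewrite member-delete x y S asc x∈S with does (y ≟ s) | proof (y ≟ s)
  ... | false | _        = refl
  ... | true  | ofʸ refl rewrite dec-false (y ≟ x) (λ y≡x → x≢s (sym y≡x)) = refl

  ⊆ᵇ-delete : ∀ x S σ → Ascending S → member x S ≡ true → not (member x σ) ∧ (σ ⊆ᵇ S) ≡ σ ⊆ᵇ delete x S
  ⊆ᵇ-delete x S []      asc x∈S = refl
  ⊆ᵇ-delete x S (y ∷ σ) asc x∈S
    rewrite member-delete x y S asc x∈S | sym (⊆ᵇ-delete x S σ asc x∈S) | ≟-sym y x
    with does (x ≟ y) | member x σ | member y S
  ... | true  | _     | true  = refl
  ... | true  | _     | false = refl
  ... | false | true  | true  = refl
  ... | false | true  | false = refl
  ... | false | false | true  = refl
  ... | false | false | false = refl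

  any-≟ : ∀ x S → any (λ y → ⌊ x ≟ y ⌋) S ≡ member x S
  any-≟ x []      = refl
  any-≟ x (y ∷ S) rewrite isYes≗does (x ≟ y) = cong (does (x ≟ y) ∨_) (any-≟ x S)

  distinct-⊆ᵇ-∷ : ∀ x σ S → Ascending S → distinct (x ∷ σ) ∧ ((x ∷ σ) ⊆ᵇ S) ≡ member x S ∧ (distinct σ ∧ (σ ⊆ᵇ delete x S))
  distinct-⊆ᵇ-∷ x σ S asc rewrite any-≟ x σ with member x S in x∈S
  ... | false = ∧-zeroʳ _
  ... | true rewrite sym (⊆ᵇ-delete x S σ asc x∈S) with member x σ | distinct σ | σ ⊆ᵇ S
  ... | true  | true  | _     = refl
  ... | true  | false | _     = refl
  ... | false | true  | true  = refl
  ... | false | true  | false = refl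
  ... | false | false | _     = refl

  interval : ℕ → ℕ → List ℕ
  interval lo zero    = []
  interval lo (suc n) = lo ∷ interval (suc lo) n

  length-interval : ∀ lo n → length (interval lo n) ≡ n
  length-interval lo zero    = refl
  length-interval lo (suc n) = cong suc (length-interval (suc lo) n)

  interval-≥ : ∀ lo n → All (lo ≤_) (interval lo n)
  interval-≥ lo zero    = []
  interval-≥ lo (suc n) = ≤-refl ∷ All.map <⇒≤ (interval-≥ (suc lo) n)

  interval-< : ∀ lo n → All (_< lo + n) (interval lo n)
  interval-< lo zero    = []
  interval-< lo (suc n) = subst (λ z → All (_< z) (lo ∷ interval (suc lo) n)) (sym (+-suc lo n))
                                (s≤s (m≤m+n lo n) ∷ interval-< (suc lo) n)

  Ascending-interval : ∀ lo n → Ascending (interval lo n)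
  Ascending-interval lo zero    = []
  Ascending-interval lo (suc n) = interval-≥ (suc lo) n ∷ Ascending-interval (suc lo) n

  member-interval : ∀ lo n x → lo ≤ x → x < lo + n → member x (interval lo n) ≡ true
  member-interval lo zero    x lo≤x x<lo+0 = ⊥-elim (<-irrefl refl (<-≤-trans x<lo+0 (subst (_≤ x) (sym (+-identityʳ lo)) lo≤x)))
  member-interval lo (suc n) x lo≤x x<lo+n with m≤n⇒m<n∨m≡n lo≤x
  ... | inj₂ refl rewrite dec-true (x ≟ x) refl = refl
  ... | inj₁ lo<x rewrite dec-false (x ≟ lo) (>⇒≢ lo<x) = member-interval (suc lo) n x lo<x (subst (x <_) (+-suc lo n) x<lo+n)

  ⊆ᵇ-interval : ∀ k B σ → Pointwise _>_ (replicate k B) σ → σ ⊆ᵇ interval 0 B ≡ true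
  ⊆ᵇ-interval zero    B []      []           = refl
  ⊆ᵇ-interval (suc k) B (x ∷ σ) (x<B ∷ σ<B) rewrite member-interval 0 B x z≤n x<B = ⊆ᵇ-interval k B σ σ<B

  -- Weakly increasing chains

  chainFrom : ℕ → List ℕ → Bool
  chainFrom = linkedFrom _≤ᵇ_

  shiftBounds : ℕ → List ℕ → List ℕ
  shiftBounds M = map (λ e → suc (e + M))

  data EndsInZero : List ℕ → Set where
    nil     : EndsInZero []
    zero∷[] : EndsInZero (0 ∷ [])
    _∷_     : ∀ e {e' es} → EndsInZero (e' ∷ es) → EndsInZero (e ∷ e' ∷ es)

  EndsInZero-tail : ∀ {e es} → EndsInZero (e ∷ es) → EndsInZero es
  EndsInZero-tail zero∷[] = nil
  EndsInZero-tail (_ ∷ z) = z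

  EndsInZero-downFrom : ∀ j → EndsInZero (downFrom j)
  EndsInZero-downFrom zero          = nil
  EndsInZero-downFrom (suc zero)    = zero∷[]
  EndsInZero-downFrom (suc (suc j)) = suc j ∷ EndsInZero-downFrom (suc j)

  EndsInZero-replicate : ∀ j → EndsInZero (replicate j 0)
  EndsInZero-replicate zero          = nil
  EndsInZero-replicate (suc zero)    = zero∷[]
  EndsInZero-replicate (suc (suc j)) = 0 ∷ EndsInZero-replicate (suc j)

  sum-downFrom : ∀ j → sum (downFrom j) ≡ j C 2
  sum-downFrom zero    = refl
  sum-downFrom (suc j) = trans (cong₂ _+_ (sym (nC1≡n j)) (sum-downFrom j)) (nCk+nC[k+1]≡[n+1]C[k+1] j 1)

  module _ where
    open import Data.Nat.Solver using (module +-*-Solver)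
    open +-*-Solver

    suc[e+[lo+L]]≡lo+[suc[L]+e] : ∀ e lo L → suc (e + (lo + L)) ≡ lo + (suc L + e)
    suc[e+[lo+L]]≡lo+[suc[L]+e] = solve 3 (λ e lo L → con 1 :+ (e :+ (lo :+ L)) := lo :+ ((con 1 :+ L) :+ e)) refl

    lo+d+n*[lo+d]≡suc[n]*lo+suc[n]*d : ∀ n lo d → lo + d + n * (lo + d) ≡ suc n * lo + suc n * d
    lo+d+n*[lo+d]≡suc[n]*lo+suc[n]*d = solve 3 (λ n lo d → lo :+ d :+ n :* (lo :+ d) := (con 1 :+ n) :* lo :+ (con 1 :+ n) :* d) refl

    e+[lo+L]∸[lo+d]+s≡e+s+[L∸d] : ∀ e lo L d s → d ≤ L → e + (lo + L) ∸ (lo + d) + s ≡ e + s + (L ∸ d)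
    e+[lo+L]∸[lo+d]+s≡e+s+[L∸d] e lo L d s d≤L = begin
      e + (lo + L) ∸ (lo + d) + s   ≡⟨ cong (λ z → z ∸ (lo + d) + s) (solve 3 (λ e lo L → e :+ (lo :+ L) := lo :+ (e :+ L)) refl e lo L) ⟩
      lo + (e + L) ∸ (lo + d) + s   ≡⟨ cong (_+ s) ([m+n]∸[m+o]≡n∸o lo (e + L) d) ⟩
      e + L ∸ d + s                 ≡⟨ cong (_+ s) (+-∸-assoc e d≤L) ⟩
      e + (L ∸ d) + s               ≡⟨ solve 3 (λ e u s → e :+ u :+ s := e :+ s :+ u) refl e (L ∸ d) s ⟩
      e + s + (L ∸ d)               ∎
      where open ≡-Reasoning

  ∧-interchange : ∀ a b x y → (a ∧ b) ∧ (x ∧ y) ≡ (a ∧ x) ∧ (b ∧ y)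
  ∧-interchange true  true  x y = refl
  ∧-interchange true  false x y = sym (∧-zeroʳ x)
  ∧-interchange false b     x y = refl

  linkedFrom-rise : ∀ c w l → linkedFrom rise (c , w) l ≡ chainFrom c (map proj₁ l) ∧ chainFrom w (map proj₂ l)
  linkedFrom-rise c w []               = refl
  linkedFrom-rise c w ((c' , w') ∷ l) rewrite linkedFrom-rise c' w' l = ∧-interchange (c ≤ᵇ c') (w ≤ᵇ w') _ _

  linked-rise : ∀ l → linked rise l ≡ chainFrom 0 (map proj₁ l) ∧ chainFrom 0 (map proj₂ l)
  linked-rise []             = refl
  linked-rise ((c , w) ∷ l) = linkedFrom-rise c w l

  codeBounds-+ : ∀ j m → codeBounds (j + m) ≡ shiftBounds m (downFrom j) ++ codeBounds m
  codeBounds-+ zero    m = refl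
  codeBounds-+ (suc j) m = cong (suc (j + m) ∷_) (codeBounds-+ j m)

  length-codeBounds : ∀ m → length (codeBounds m) ≡ m
  length-codeBounds zero    = refl
  length-codeBounds (suc m) = cong suc (length-codeBounds m)

  take-length-++ : ∀ {a} {A : Set a} (xs ys : List A) → take (length xs) (xs ++ ys) ≡ xs
  take-length-++ []       ys = refl
  take-length-++ (x ∷ xs) ys = cong (x ∷_) (take-length-++ xs ys)

  drop-length-++ : ∀ {a} {A : Set a} (xs ys : List A) → drop (length xs) (xs ++ ys) ≡ ys
  drop-length-++ []       ys = refl
  drop-length-++ (x ∷ xs) ys = drop-length-++ xs ys

open Combinatorics

module _ {c ℓ : Level} (R : CommutativeRing c ℓ) where
  open CommutativeRing R
  open Gen R
  open import Algebra.Solver.Ring.NaturalCoefficients.Default commutativeSemiring hiding (⟦_⟧)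
  open import Relation.Binary.Reasoning.Setoid setoid
  open import Algebra.Properties.CommutativeSemigroup *-commutativeSemigroup using (x∙yz≈y∙xz; interchange)
  open import Algebra.Properties.CommutativeSemigroup +-commutativeSemigroup as + using ()

  ∑< : ℕ → (ℕ → Carrier) → Carrier
  ∑< zero    f = 0#
  ∑< (suc n) f = f 0 + ∑< n (λ i → f (suc i))

  syntax ∑< n (λ i → e) = ∑[ i < n ] e

  Σ-map-applyUpTo : ∀ (f : ℕ → Carrier) g n → Σ (map f (applyUpTo g n)) ≡ ∑[ i < n ] f (g i)
  Σ-map-applyUpTo f g zero    = ≡.refl
  Σ-map-applyUpTo f g (suc n) = ≡.cong (f (g 0) +_) (Σ-map-applyUpTo f (λ i → g (suc i)) n)

  ∑-cong< : ∀ n {f g : ℕ → Carrier} → (∀ i → i < n → f i ≈ g i) → ∑< n f ≈ ∑< n g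
  ∑-cong< zero    f≈g = refl
  ∑-cong< (suc n) f≈g = +-cong (f≈g 0 (s≤s z≤n)) (∑-cong< n (λ i i<n → f≈g (suc i) (s≤s i<n)))

  ∑-cong : ∀ n {f g : ℕ → Carrier} → (∀ i → f i ≈ g i) → ∑< n f ≈ ∑< n g
  ∑-cong n f≈g = ∑-cong< n (λ i _ → f≈g i)

  ∑-0 : ∀ n → ∑[ i < n ] 0# ≈ 0#
  ∑-0 zero    = refl
  ∑-0 (suc n) = trans (+-identityˡ _) (∑-0 n)

  ∑-+ : ∀ n (f g : ℕ → Carrier) → ∑[ i < n ] (f i + g i) ≈ ∑< n f + ∑< n g
  ∑-+ zero    f g = sym (+-identityˡ _)
  ∑-+ (suc n) f g = trans (+-congˡ (∑-+ n _ _)) (+.interchange _ _ _ _)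

  ∑-*ˡ : ∀ n a (f : ℕ → Carrier) → ∑[ i < n ] (a * f i) ≈ a * ∑< n f
  ∑-*ˡ zero    a f = sym (zeroʳ a)
  ∑-*ˡ (suc n) a f = trans (+-congˡ (∑-*ˡ n a _)) (sym (distribˡ a _ _))

  ∑-*ʳ : ∀ n a (f : ℕ → Carrier) → ∑[ i < n ] (f i * a) ≈ ∑< n f * a
  ∑-*ʳ n a f = trans (∑-cong n (λ i → *-comm (f i) a)) (trans (∑-*ˡ n a f) (*-comm a _))

  ∑-++ : ∀ a b (f : ℕ → Carrier) → ∑< (a ℕ.+ b) f ≈ ∑< a f + ∑[ i < b ] f (a ℕ.+ i)
  ∑-++ zero    b f = sym (+-identityˡ _)
  ∑-++ (suc a) b f = trans (+-congˡ (∑-++ a b _)) (sym (+-assoc _ _ _))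

  ∑-last : ∀ n (f : ℕ → Carrier) → ∑< (suc n) f ≈ ∑< n f + f n
  ∑-last n f = begin
    ∑< (suc n) f                      ≡⟨ ≡.cong (λ m → ∑< m f) (ℕ.+-comm 1 n) ⟩
    ∑< (n ℕ.+ 1) f                    ≈⟨ ∑-++ n 1 f ⟩
    ∑< n f + (f (n ℕ.+ 0) + 0#)       ≈⟨ +-congˡ (trans (+-identityʳ _) (reflexive (≡.cong f (ℕ.+-identityʳ n)))) ⟩
    ∑< n f + f n                      ∎

  ∑-reverse : ∀ n (f : ℕ → Carrier) → ∑< n f ≈ ∑[ i < n ] f (n ∸ suc i)
  ∑-reverse zero    f = refl
  ∑-reverse (suc n) f = begin
    f 0 + ∑[ i < n ] f (suc i)                        ≈⟨ +-comm _ _ ⟩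
    ∑[ i < n ] f (suc i) + f 0                        ≈⟨ +-congʳ (∑-reverse n _) ⟩
    ∑[ i < n ] f (suc (n ∸ suc i)) + f 0
      ≈⟨ +-cong (∑-cong< n (λ i i<n → reflexive (≡.cong f (≡.sym (ℕ.+-∸-assoc 1 i<n)))))
                (reflexive (≡.cong f (≡.sym (ℕ.n∸n≡0 n)))) ⟩
    ∑[ i < n ] f (suc n ∸ suc i) + f (suc n ∸ suc n)  ≈⟨ ∑-last n _ ⟨
    ∑[ i < suc n ] f (suc n ∸ suc i)                  ∎

  ∑-*-∑ : ∀ n m (f g : ℕ → Carrier) → ∑< n f * ∑< m g ≈ ∑[ i < n ] ∑[ j < m ] (f i * g j)
  ∑-*-∑ n m f g = trans (sym (∑-*ʳ n _ f)) (∑-cong n (λ i → sym (∑-*ˡ m (f i) g)))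

  pow-+ : ∀ x a b → pow x (a ℕ.+ b) ≈ pow x a * pow x b
  pow-+ x zero    b = sym (*-identityˡ _)
  pow-+ x (suc a) b = trans (*-congˡ (pow-+ x a b)) (sym (*-assoc _ _ _))

  pow-merge : ∀ x a b {d} → a ℕ.+ b ≡ d → pow x a * pow x b ≈ pow x d
  pow-merge x a b a+b≡d = trans (sym (pow-+ x a b)) (reflexive (≡.cong (pow x) a+b≡d))

  pow-1# : ∀ n → pow 1# n ≈ 1#
  pow-1# zero    = refl
  pow-1# (suc n) = trans (*-identityˡ _) (pow-1# n)

  ⟦_⟧ : Bool → Carrier
  ⟦ true  ⟧ = 1#
  ⟦ false ⟧ = 0#

  ⟦∧⟧ : ∀ a b → ⟦ a ∧ b ⟧ ≈ ⟦ a ⟧ * ⟦ b ⟧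
  ⟦∧⟧ true  b = sym (*-identityˡ _)
  ⟦∧⟧ false b = sym (zeroˡ _)

  pqInt-∑ : ∀ x y n → pqInt x y n ≡ ∑[ i < n ] (pow x (n ∸ 1 ∸ i) * pow y i)
  pqInt-∑ x y n = Σ-map-applyUpTo (λ i → pow x (n ∸ 1 ∸ i) * pow y i) (λ i → i) n

  pqInt-suc : ∀ x y n → pqInt x y (suc n) ≈ pow x n + y * pqInt x y n
  pqInt-suc x y n = begin
    pqInt x y (suc n)                                              ≡⟨ pqInt-∑ x y (suc n) ⟩
    pow x n * 1# + ∑[ i < n ] (pow x (n ∸ suc i) * (y * pow y i))
      ≈⟨ +-cong (*-identityʳ _) (∑-cong n (λ i → trans (*-congʳ (reflexive (≡.cong (pow x) (≡.sym (ℕ.∸-+-assoc n 1 i)))))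
                                                        (x∙yz≈y∙xz _ y _))) ⟩
    pow x n + ∑[ i < n ] (y * (pow x (n ∸ 1 ∸ i) * pow y i))       ≈⟨ +-congˡ (∑-*ˡ n y _) ⟩
    pow x n + y * ∑[ i < n ] (pow x (n ∸ 1 ∸ i) * pow y i)         ≡⟨ ≡.cong (λ z → pow x n + y * z) (≡.sym (pqInt-∑ x y n)) ⟩
    pow x n + y * pqInt x y n                                      ∎

  pqInt-+ : ∀ x y a b → pqInt x y (a ℕ.+ b) ≈ pow x b * pqInt x y a + pow y a * pqInt x y b
  pqInt-+ x y zero    b = begin
    pqInt x y b                          ≈⟨ solve 1 (λ t → t := con 0 :+ con 1 :* t) refl (pqInt x y b) ⟩
    0# + 1# * pqInt x y b                ≈⟨ +-congʳ (zeroʳ _) ⟨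
    pow x b * 0# + 1# * pqInt x y b      ∎
  pqInt-+ x y (suc a) b = begin
    pqInt x y (suc (a ℕ.+ b))                                                 ≈⟨ pqInt-suc x y (a ℕ.+ b) ⟩
    pow x (a ℕ.+ b) + y * pqInt x y (a ℕ.+ b)                                 ≈⟨ +-cong (pow-+ x a b) (*-congˡ (pqInt-+ x y a b)) ⟩
    pow x a * pow x b + y * (pow x b * pqInt x y a + pow y a * pqInt x y b)   ≈⟨ regroup _ _ _ _ _ _ ⟩
    pow x b * (pow x a + y * pqInt x y a) + (y * pow y a) * pqInt x y b       ≈⟨ +-congʳ (*-congˡ (pqInt-suc x y a)) ⟨
    pow x b * pqInt x y (suc a) + pow y (suc a) * pqInt x y b                 ∎
    where
    regroup : ∀ A B Y P C Q → A * B + Y * (B * P + C * Q) ≈ B * (A + Y * P) + (Y * C) * Q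
    regroup = solve 6 (λ A B Y P C Q → A :* B :+ Y :* (B :* P :+ C :* Q) := B :* (A :+ Y :* P) :+ (Y :* C) :* Q) refl

  -- The (y,x)-binomial [j+L choose j], expanded by the smallest part d of a weakly increasing
  -- j-tuple in [0,L]: this is the shape in which chain sums evaluate (chainSum-eval below).
  gauss : Carrier → Carrier → ℕ → ℕ → Carrier
  gauss x y zero    L = 1#
  gauss x y (suc j) L = ∑[ d < suc L ] (pow x (suc j ℕ.* d) * pow y (L ∸ d) * gauss x y j (L ∸ d))

  gauss-0 : ∀ x y j → gauss x y j 0 ≈ 1#
  gauss-0 x y zero    = refl
  gauss-0 x y (suc j) = begin
    pow x (suc j ℕ.* 0) * pow y 0 * gauss x y j 0 + 0#  ≈⟨ +-identityʳ _ ⟩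
    pow x (suc j ℕ.* 0) * 1# * gauss x y j 0            ≈⟨ *-cong (*-congʳ (reflexive (≡.cong (pow x) (ℕ.*-zeroʳ (suc j))))) (gauss-0 x y j) ⟩
    1# * 1# * 1#                                        ≈⟨ trans (*-identityʳ _) (*-identityʳ _) ⟩
    1#                                                  ∎

  gauss-pascal : ∀ x y j L → gauss x y (suc j) (suc L) ≈ pow y (suc L) * gauss x y j (suc L) + pow x (suc j) * gauss x y (suc j) L
  gauss-pascal x y j L =
    +-cong smallest0 (trans (∑-cong (suc L) shift) (∑-*ˡ (suc L) (pow x (suc j)) (λ d → pow x (suc j ℕ.* d) * pow y (L ∸ d) * gauss x y j (L ∸ d))))
    where
    smallest0 : pow x (suc j ℕ.* 0) * pow y (suc L) * gauss x y j (suc L) ≈ pow y (suc L) * gauss x y j (suc L)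
    smallest0 = *-congʳ (trans (*-congʳ (reflexive (≡.cong (pow x) (ℕ.*-zeroʳ (suc j))))) (*-identityˡ _))
    shift : ∀ d → pow x (suc j ℕ.* suc d) * pow y (L ∸ d) * gauss x y j (L ∸ d) ≈
                  pow x (suc j) * (pow x (suc j ℕ.* d) * pow y (L ∸ d) * gauss x y j (L ∸ d))
    shift d = begin
      pow x (suc j ℕ.* suc d) * pow y (L ∸ d) * gauss x y j (L ∸ d)
        ≈⟨ *-congʳ (*-congʳ (trans (reflexive (≡.cong (pow x) (ℕ.*-suc (suc j) d))) (pow-+ x (suc j) _))) ⟩
      pow x (suc j) * pow x (suc j ℕ.* d) * pow y (L ∸ d) * gauss x y j (L ∸ d)
        ≈⟨ solve 4 (λ a b e g → a :* b :* e :* g := a :* (b :* e :* g)) refl _ _ _ _ ⟩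
      pow x (suc j) * (pow x (suc j ℕ.* d) * pow y (L ∸ d) * gauss x y j (L ∸ d)) ∎

  gauss-pqFact : ∀ x y j M → gauss x y j M * pqFact y x j * pqFact y x M ≈ pqFact y x (j ℕ.+ M)
  gauss-pqFact x y zero    M = trans (*-congʳ (*-identityˡ _)) (*-identityˡ _)
  gauss-pqFact x y (suc j) zero = begin
    gauss x y (suc j) 0 * pqFact y x (suc j) * 1#   ≈⟨ *-identityʳ _ ⟩
    gauss x y (suc j) 0 * pqFact y x (suc j)        ≈⟨ trans (*-congʳ (gauss-0 x y (suc j))) (*-identityˡ _) ⟩
    pqFact y x (suc j)                              ≡⟨ ≡.cong (pqFact y x) (≡.sym (ℕ.+-identityʳ (suc j))) ⟩
    pqFact y x (suc j ℕ.+ 0)                        ∎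
  gauss-pqFact x y (suc j) (suc M) = begin
    gauss x y (suc j) (suc M) * (I (suc j) * F j) * (I (suc M) * F M)
      ≈⟨ *-congʳ (*-congʳ (gauss-pascal x y j M)) ⟩
    (pow y (suc M) * gauss x y j (suc M) + pow x (suc j) * gauss x y (suc j) M) * (I (suc j) * F j) * (I (suc M) * F M)
      ≈⟨ regroup _ _ _ _ _ _ _ _ ⟩
    (pow y (suc M) * I (suc j)) * (gauss x y j (suc M) * F j * F (suc M)) + (pow x (suc j) * I (suc M)) * (gauss x y (suc j) M * F (suc j) * F M)
      ≈⟨ +-cong (*-congˡ (gauss-pqFact x y j (suc M))) (*-congˡ (gauss-pqFact x y (suc j) M)) ⟩
    (pow y (suc M) * I (suc j)) * F (j ℕ.+ suc M) + (pow x (suc j) * I (suc M)) * F (suc (j ℕ.+ M))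
      ≡⟨ ≡.cong (λ z → (pow y (suc M) * I (suc j)) * F z + (pow x (suc j) * I (suc M)) * F (suc (j ℕ.+ M))) (ℕ.+-suc j M) ⟩
    (pow y (suc M) * I (suc j)) * F (suc (j ℕ.+ M)) + (pow x (suc j) * I (suc M)) * F (suc (j ℕ.+ M))
      ≈⟨ distribʳ _ _ _ ⟨
    (pow y (suc M) * I (suc j) + pow x (suc j) * I (suc M)) * F (suc (j ℕ.+ M))
      ≈⟨ *-congʳ (pqInt-+ y x (suc j) (suc M)) ⟨
    I (suc j ℕ.+ suc M) * F (suc (j ℕ.+ M))
      ≡⟨ ≡.cong (λ z → I (suc j ℕ.+ suc M) * F z) (≡.sym (ℕ.+-suc j M)) ⟩
    pqFact y x (suc j ℕ.+ suc M) ∎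
    where
    I = pqInt y x
    F = pqFact y x
    regroup : ∀ a h₁ b h₂ d f e g → (a * h₁ + b * h₂) * (d * f) * (e * g) ≈ (a * d) * (h₁ * f * (e * g)) + (b * e) * (h₂ * (d * f) * g)
    regroup = solve 8 (λ a h₁ b h₂ d f e g → (a :* h₁ :+ b :* h₂) :* (d :* f) :* (e :* g) :=
                                             (a :* d) :* (h₁ :* f :* (e :* g)) :+ (b :* e) :* (h₂ :* (d :* f) :* g)) refl

  codeSum : Carrier → Carrier → List ℕ → (List ℕ → Carrier) → Carrier
  codeSum x y []       g = g []
  codeSum x y (b ∷ bs) g = ∑[ c < b ] ((pow x c * pow y (b ∸ 1 ∸ c)) * codeSum x y bs (λ l → g (c ∷ l)))

  codeSum-cong : ∀ x y bs {g h : List ℕ → Carrier} → (∀ l → g l ≈ h l) → codeSum x y bs g ≈ codeSum x y bs h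
  codeSum-cong x y []       g≈h = g≈h []
  codeSum-cong x y (b ∷ bs) g≈h = ∑-cong b (λ c → *-congˡ (codeSum-cong x y bs (λ l → g≈h (c ∷ l))))

  codeSum-*ˡ : ∀ x y bs a (g : List ℕ → Carrier) → codeSum x y bs (λ l → a * g l) ≈ a * codeSum x y bs g
  codeSum-*ˡ x y []       a g = refl
  codeSum-*ˡ x y (b ∷ bs) a g = trans (∑-cong b (λ c → trans (*-congˡ (codeSum-*ˡ x y bs a _)) (x∙yz≈y∙xz _ a _))) (∑-*ˡ b a _)

  codeSum-0 : ∀ x y bs → codeSum x y bs (λ _ → 0#) ≈ 0#
  codeSum-0 x y bs = trans (codeSum-cong x y bs (λ _ → sym (zeroˡ 0#))) (trans (codeSum-*ˡ x y bs 0# (λ _ → 0#)) (zeroˡ _))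

  ⟦≤ᵇ⟧-codeSum : ∀ x y bs lo c →
    codeSum x y bs (λ l → ⟦ (lo ≤ᵇ c) ∧ chainFrom c l ⟧) ≈ ⟦ lo ≤ᵇ c ⟧ * codeSum x y bs (λ l → ⟦ chainFrom c l ⟧)
  ⟦≤ᵇ⟧-codeSum x y bs lo c = trans (codeSum-cong x y bs (λ l → ⟦∧⟧ (lo ≤ᵇ c) _)) (codeSum-*ˡ x y bs _ _)

  -- The last bound is M + 1, so a weakly increasing code cannot start above M.
  chainSum-above : ∀ x y M e es lo → EndsInZero (e ∷ es) → M < lo →
                   codeSum x y (shiftBounds M (e ∷ es)) (λ l → ⟦ chainFrom lo l ⟧) ≈ 0#
  chainSum-above x y M .0 .[] lo zero∷[] M<lo = trans (∑-cong< (suc M) vanish) (∑-0 (suc M))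
    where
    vanish : ∀ c → c < suc M → (pow x c * pow y (suc M ∸ 1 ∸ c)) * ⟦ (lo ≤ᵇ c) ∧ true ⟧ ≈ 0#
    vanish c c≤M rewrite dec-false (lo ≤? c) (ℕ.<⇒≱ (ℕ.<-≤-trans c≤M M<lo)) = zeroʳ _
  chainSum-above x y M e (e' ∷ es) lo (.e ∷ z) M<lo = trans (∑-cong (suc (e ℕ.+ M)) vanish) (∑-0 (suc (e ℕ.+ M)))
    where
    vanish : ∀ c → (pow x c * pow y (suc (e ℕ.+ M) ∸ 1 ∸ c)) * codeSum x y (shiftBounds M (e' ∷ es)) (λ l → ⟦ (lo ≤ᵇ c) ∧ chainFrom c l ⟧) ≈ 0#
    vanish c with lo ≤ᵇ c | proof (lo ≤? c)
    ... | false | _        = trans (*-congˡ (codeSum-0 x y (shiftBounds M (e' ∷ es)))) (zeroʳ _)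
    ... | true  | ofʸ lo≤c = trans (*-congˡ (chainSum-above x y M e' es c z (ℕ.<-≤-trans M<lo lo≤c))) (zeroʳ _)

  -- A weakly increasing code starting at lo with bounds (e_i + M + 1) and last bound M + 1 stays in [lo, M];
  -- splitting off its first letter lo + d gives the recursion defining gauss.
  chainSum-eval : ∀ x y es lo L M → EndsInZero es → lo ℕ.+ L ≡ M →
                  codeSum x y (shiftBounds M es) (λ l → ⟦ chainFrom lo l ⟧) ≈ pow x (length es ℕ.* lo) * pow y (sum es) * gauss x y (length es) L
  chainSum-eval x y []       lo L M _ _      = sym (trans (*-identityʳ _) (*-identityʳ _))
  chainSum-eval x y (e ∷ es) lo L _ z ≡.refl = begin
    ∑< (suc (e ℕ.+ M)) T
      ≈⟨ ∑-cong (suc (e ℕ.+ M)) (λ c → *-congˡ {pow x c * pow y (e ℕ.+ M ∸ c)} (⟦≤ᵇ⟧-codeSum x y rest lo c)) ⟩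
    ∑< (suc (e ℕ.+ M)) T'                                             ≡⟨ ≡.cong (λ m → ∑< m T') (suc[e+[lo+L]]≡lo+[suc[L]+e] e lo L) ⟩
    ∑< (lo ℕ.+ (suc L ℕ.+ e)) T'                                      ≈⟨ ∑-++ lo _ T' ⟩
    ∑< lo T' + ∑[ i < suc L ℕ.+ e ] T' (lo ℕ.+ i)                     ≈⟨ +-cong below (∑-++ (suc L) e (λ i → T' (lo ℕ.+ i))) ⟩
    0# + (∑[ d < suc L ] T' (lo ℕ.+ d) + ∑[ i < e ] T' (lo ℕ.+ (suc L ℕ.+ i)))
                                                                      ≈⟨ trans (+-identityˡ _) (+-congˡ (above z)) ⟩
    ∑[ d < suc L ] T' (lo ℕ.+ d) + 0#                                 ≈⟨ +-identityʳ _ ⟩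
    ∑[ d < suc L ] T' (lo ℕ.+ d)                                      ≈⟨ ∑-cong< (suc L) inside ⟩
    ∑[ d < suc L ] (pow x (suc n ℕ.* lo) * pow y (e ℕ.+ sum es) * G d)  ≈⟨ ∑-*ˡ (suc L) _ G ⟩
    pow x (suc n ℕ.* lo) * pow y (e ℕ.+ sum es) * gauss x y (suc n) L ∎
    where
    M = lo ℕ.+ L
    n = length es
    rest = shiftBounds M es
    T T' : ℕ → Carrier
    T  c = (pow x c * pow y (e ℕ.+ M ∸ c)) * codeSum x y rest (λ l → ⟦ (lo ≤ᵇ c) ∧ chainFrom c l ⟧)
    T' c = (pow x c * pow y (e ℕ.+ M ∸ c)) * (⟦ lo ≤ᵇ c ⟧ * codeSum x y rest (λ l → ⟦ chainFrom c l ⟧))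
    G : ℕ → Carrier
    G d = pow x (suc n ℕ.* d) * pow y (L ∸ d) * gauss x y n (L ∸ d)
    below : ∑< lo T' ≈ 0#
    below = trans (∑-cong< lo (λ c c<lo → trans (*-congˡ (trans (*-congʳ (reflexive (≡.cong ⟦_⟧ (dec-false (lo ≤? c) (ℕ.<⇒≱ c<lo)))))
                                                                  (zeroˡ _))) (zeroʳ _)))
                  (∑-0 lo)
    above : EndsInZero (e ∷ es) → ∑[ i < e ] T' (lo ℕ.+ (suc L ℕ.+ i)) ≈ 0#
    above zero∷[]        = refl
    above (_ ∷ z')       = trans (∑-cong e vanish) (∑-0 e)
      where
      vanish : ∀ i → T' (lo ℕ.+ (suc L ℕ.+ i)) ≈ 0#
      vanish i = trans (*-congˡ (trans (*-congʳ (reflexive (≡.cong ⟦_⟧ (dec-true (lo ≤? _) (ℕ.m≤m+n lo _)))))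
                                (trans (*-identityˡ _) (chainSum-above x y M _ _ _ z' M<i)))) (zeroʳ _)
        where
        M<i : M < lo ℕ.+ (suc L ℕ.+ i)
        M<i = ℕ.≤-trans (ℕ.≤-reflexive (≡.sym (ℕ.+-suc lo L))) (ℕ.≤-trans (ℕ.m≤m+n (lo ℕ.+ suc L) i) (ℕ.≤-reflexive (ℕ.+-assoc lo (suc L) i)))
    inside : ∀ d → d < suc L → T' (lo ℕ.+ d) ≈ pow x (suc n ℕ.* lo) * pow y (e ℕ.+ sum es) * G d
    inside d (s≤s d≤L) = begin
      (pow x (lo ℕ.+ d) * pow y (e ℕ.+ M ∸ (lo ℕ.+ d))) * (⟦ lo ≤ᵇ lo ℕ.+ d ⟧ * codeSum x y rest (λ l → ⟦ chainFrom (lo ℕ.+ d) l ⟧))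
        ≈⟨ *-congˡ (*-cong (reflexive (≡.cong ⟦_⟧ (dec-true (lo ≤? lo ℕ.+ d) (ℕ.m≤m+n lo d))))
                           (chainSum-eval x y es (lo ℕ.+ d) (L ∸ d) M (EndsInZero-tail z) lo+d+[L∸d]≡M)) ⟩
      pow x (lo ℕ.+ d) * pow y (e ℕ.+ M ∸ (lo ℕ.+ d)) * (1# * (pow x (n ℕ.* (lo ℕ.+ d)) * pow y (sum es) * gauss x y n (L ∸ d)))
        ≈⟨ regroup _ _ _ _ _ ⟩
      (pow x (lo ℕ.+ d) * pow x (n ℕ.* (lo ℕ.+ d))) * (pow y (e ℕ.+ M ∸ (lo ℕ.+ d)) * pow y (sum es)) * gauss x y n (L ∸ d)
        ≈⟨ *-congʳ (*-cong (trans (pow-merge x (lo ℕ.+ d) (n ℕ.* (lo ℕ.+ d)) (lo+d+n*[lo+d]≡suc[n]*lo+suc[n]*d n lo d)) (pow-+ x (suc n ℕ.* lo) (suc n ℕ.* d)))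
                           (trans (pow-merge y (e ℕ.+ M ∸ (lo ℕ.+ d)) (sum es) (e+[lo+L]∸[lo+d]+s≡e+s+[L∸d] e lo L d (sum es) d≤L))
                                  (pow-+ y (e ℕ.+ sum es) (L ∸ d)))) ⟩
      (pow x (suc n ℕ.* lo) * pow x (suc n ℕ.* d)) * (pow y (e ℕ.+ sum es) * pow y (L ∸ d)) * gauss x y n (L ∸ d)
        ≈⟨ solve 5 (λ A B C D h → (A :* B) :* (C :* D) :* h := A :* C :* (B :* D :* h)) refl _ _ _ _ _ ⟩
      pow x (suc n ℕ.* lo) * pow y (e ℕ.+ sum es) * G d ∎
      where
      lo+d+[L∸d]≡M : lo ℕ.+ d ℕ.+ (L ∸ d) ≡ M
      lo+d+[L∸d]≡M = ≡.trans (ℕ.+-assoc lo d (L ∸ d)) (≡.cong (lo ℕ.+_) (ℕ.m+[n∸m]≡n d≤L))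
      regroup : ∀ X₁ Y₁ X₂ Y₂ h → X₁ * Y₁ * (1# * (X₂ * Y₂ * h)) ≈ (X₁ * X₂) * (Y₁ * Y₂) * h
      regroup = solve 5 (λ X₁ Y₁ X₂ Y₂ h → X₁ :* Y₁ :* (con 1 :* (X₂ :* Y₂ :* h)) := (X₁ :* X₂) :* (Y₁ :* Y₂) :* h) refl

  -- Sign-reversing cancellation

  module _ {a} {A : Set a} (rel : A → A → Bool) where

    alternatingRuns : List A → Carrier
    alternatingRuns l = ∑[ j < suc (length l) ] (pow (- 1#) j * (⟦ linked rel (take j l) ⟧ * ⟦ linked (λ u v → not (rel u v)) (drop j l) ⟧))

    -- alternatingRuns (u ∷ v ∷ l), unfolded: its terms j ≥ 2 are −⟦rel u v⟧ times the terms j ≥ 1 of alternatingRuns (v ∷ l).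
    private
      alternatingRuns-step : ∀ ρ nr n (X : ℕ → Bool) (Z : ℕ → Carrier) →
        1# * (1# * ⟦ nr ⟧) + ∑[ j < n ] ((- 1# * pow (- 1#) j) * (⟦ X j ⟧ * Z j)) ≈ 0# →
        1# * (1# * ⟦ not ρ ∧ nr ⟧) + ((- 1# * 1#) * (1# * ⟦ nr ⟧) + ∑[ j < n ] ((- 1# * (- 1# * pow (- 1#) j)) * (⟦ ρ ∧ X j ⟧ * Z j))) ≈ 0#
      alternatingRuns-step true nr n X Z tail≈0 = begin
        1# * (1# * 0#) + ((- 1# * 1#) * (1# * ⟦ nr ⟧) + ∑[ j < n ] ((- 1# * (- 1# * pow (- 1#) j)) * (⟦ X j ⟧ * Z j)))
          ≈⟨ +-congˡ (+-congˡ (trans (∑-cong n (λ j → solve 4 (λ m P X Z → (m :* (m :* P)) :* (X :* Z) := m :* ((m :* P) :* (X :* Z))) refl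
                                                              (- 1#) (pow (- 1#) j) ⟦ X j ⟧ (Z j)))
                                     (∑-*ˡ n (- 1#) _))) ⟩
        1# * (1# * 0#) + ((- 1# * 1#) * (1# * ⟦ nr ⟧) + - 1# * ∑[ j < n ] ((- 1# * pow (- 1#) j) * (⟦ X j ⟧ * Z j)))
          ≈⟨ solve 3 (λ m A S → con 1 :* (con 1 :* con 0) :+ ((m :* con 1) :* (con 1 :* A) :+ m :* S) := m :* (con 1 :* (con 1 :* A) :+ S)) refl _ _ _ ⟩
        - 1# * (1# * (1# * ⟦ nr ⟧) + ∑[ j < n ] ((- 1# * pow (- 1#) j) * (⟦ X j ⟧ * Z j)))
          ≈⟨ *-congˡ tail≈0 ⟩
        - 1# * 0#
          ≈⟨ zeroʳ _ ⟩
        0# ∎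
      alternatingRuns-step false nr n X Z _ = begin
        1# * (1# * ⟦ nr ⟧) + ((- 1# * 1#) * (1# * ⟦ nr ⟧) + ∑[ j < n ] ((- 1# * (- 1# * pow (- 1#) j)) * (0# * Z j)))
          ≈⟨ solve 3 (λ m A Z → con 1 :* (con 1 :* A) :+ ((m :* con 1) :* (con 1 :* A) :+ Z) := (con 1 :+ m) :* A :+ Z) refl _ _ _ ⟩
        (1# + - 1#) * ⟦ nr ⟧ + ∑[ j < n ] ((- 1# * (- 1# * pow (- 1#) j)) * (0# * Z j))
          ≈⟨ +-cong (trans (*-congʳ (-‿inverseʳ 1#)) (zeroˡ _)) (trans (∑-cong n (λ j → trans (*-congˡ (zeroˡ _)) (zeroʳ _))) (∑-0 n)) ⟩
        0# + 0#
          ≈⟨ +-identityʳ _ ⟩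
        0# ∎

    alternatingRuns-∷ : ∀ u l → alternatingRuns (u ∷ l) ≈ 0#
    alternatingRuns-∷ u []      = trans (solve 1 (λ m → con 1 :* (con 1 :* con 1) :+ ((m :* con 1) :* (con 1 :* con 1) :+ con 0) := con 1 :+ m) refl (- 1#))
                                        (-‿inverseʳ 1#)
    alternatingRuns-∷ u (v ∷ l) =
      alternatingRuns-step (rel u v) (linkedFrom (λ u v → not (rel u v)) v l) (suc (length l))
                           (λ j → linkedFrom rel v (take j l)) (λ j → ⟦ linked (λ u v → not (rel u v)) (drop j l) ⟧)
                           (alternatingRuns-∷ v l)

  Σ-++ : ∀ xs ys → Σ (xs ++ ys) ≈ Σ xs + Σ ys
  Σ-++ []       ys = sym (+-identityˡ _)
  Σ-++ (x ∷ xs) ys = trans (+-congˡ (Σ-++ xs ys)) (sym (+-assoc _ _ _))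

  Σ-map-cong : ∀ {a} {A : Set a} {f g : A → Carrier} xs → (∀ x → f x ≈ g x) → Σ (map f xs) ≈ Σ (map g xs)
  Σ-map-cong []       f≈g = refl
  Σ-map-cong (x ∷ xs) f≈g = +-cong (f≈g x) (Σ-map-cong xs f≈g)

  Σ-concatMap : ∀ {a} {A : Set a} (f : A → List Carrier) xs → Σ (concatMap f xs) ≈ Σ (map (λ x → Σ (f x)) xs)
  Σ-concatMap f []       = refl
  Σ-concatMap f (x ∷ xs) = trans (Σ-++ (f x) _) (+-congˡ (Σ-concatMap f xs))

  Σ-map-concatMap : ∀ {a b} {A : Set a} {B : Set b} (h : B → Carrier) (f : A → List B) xs →
                    Σ (map h (concatMap f xs)) ≈ Σ (map (λ x → Σ (map h (f x))) xs)
  Σ-map-concatMap h f xs = trans (reflexive (≡.cong Σ (map-concatMap h f xs))) (Σ-concatMap (λ x → map h (f x)) xs)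

  Σ-filter : ∀ {a} {A : Set a} (D : A → Bool) (g : A → Carrier) xs →
             Σ (map g (filter (λ x → D x Bool.≟ true) xs)) ≈ Σ (map (λ x → ⟦ D x ⟧ * g x) xs)
  Σ-filter D g []       = refl
  Σ-filter D g (x ∷ xs) with D x
  ... | true  = +-cong (sym (*-identityˡ _)) (Σ-filter D g xs)
  ... | false = trans (sym (+-identityˡ _)) (+-cong (sym (zeroˡ _)) (Σ-filter D g xs))

  Σ-tabulate : ∀ m (h : ℕ → Carrier) → Σ (tabulate {n = m} (λ i → h (toℕ i))) ≡ ∑< m h
  Σ-tabulate zero    h = ≡.refl
  Σ-tabulate (suc m) h = ≡.cong (h 0 +_) (Σ-tabulate m (λ i → h (suc i)))

  boxSum : List ℕ → (List ℕ → Carrier) → Carrier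
  boxSum []       G = G []
  boxSum (b ∷ bs) G = ∑[ x < b ] boxSum bs (λ l → G (x ∷ l))

  boxSum-cong : ∀ bs {f g : List ℕ → Carrier} → (∀ l → Pointwise _>_ bs l → f l ≈ g l) → boxSum bs f ≈ boxSum bs g
  boxSum-cong []       f≈g = f≈g [] []
  boxSum-cong (b ∷ bs) f≈g = ∑-cong< b (λ x x<b → boxSum-cong bs (λ l l<bs → f≈g (x ∷ l) (x<b ∷ l<bs)))

  boxSum-*ˡ : ∀ bs a (f : List ℕ → Carrier) → boxSum bs (λ l → a * f l) ≈ a * boxSum bs f
  boxSum-*ˡ []       a f = refl
  boxSum-*ˡ (b ∷ bs) a f = trans (∑-cong b (λ x → boxSum-*ˡ bs a _)) (∑-*ˡ b a _)

  boxSum-0 : ∀ bs → boxSum bs (λ _ → 0#) ≈ 0#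
  boxSum-0 bs = trans (boxSum-cong bs (λ _ _ → sym (zeroˡ 0#))) (trans (boxSum-*ˡ bs 0# (λ _ → 0#)) (zeroˡ _))

  boxSum-+ : ∀ bs (f g : List ℕ → Carrier) → boxSum bs (λ l → f l + g l) ≈ boxSum bs f + boxSum bs g
  boxSum-+ []       f g = refl
  boxSum-+ (b ∷ bs) f g = trans (∑-cong b (λ x → boxSum-+ bs _ _)) (∑-+ b _ _)

  boxSum-∑ : ∀ bs n (F : ℕ → List ℕ → Carrier) → boxSum bs (λ l → ∑[ j < n ] F j l) ≈ ∑[ j < n ] boxSum bs (F j)
  boxSum-∑ bs zero    F = boxSum-0 bs
  boxSum-∑ bs (suc n) F = trans (boxSum-+ bs (F 0) _) (+-congˡ (boxSum-∑ bs n (λ j → F (suc j))))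

  Σ-words : ∀ m n (G : List ℕ → Carrier) → Σ (map (λ v → G (map toℕ (toList v))) (words m n)) ≈ boxSum (replicate n m) G
  Σ-words m zero    G = +-identityʳ _
  Σ-words m (suc n) G = begin
    Σ (map G' (concatMap (λ x → map (x ∷ᵥ_) (words m n)) (allFin m)))
      ≈⟨ Σ-map-concatMap G' (λ x → map (x ∷ᵥ_) (words m n)) (allFin m) ⟩
    Σ (map (λ x → Σ (map G' (map (x ∷ᵥ_) (words m n)))) (allFin m))
      ≈⟨ Σ-map-cong (allFin m) (λ x → trans (reflexive (≡.cong Σ (≡.sym (map-∘ (words m n))))) (Σ-words m n (λ l → G (toℕ x ∷ l)))) ⟩
    Σ (map (λ x → boxSum (replicate n m) (λ l → G (toℕ x ∷ l))) (allFin m))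
      ≡⟨ ≡.cong Σ (map-tabulate {n = m} (λ i → i) (λ x → boxSum (replicate n m) (λ l → G (toℕ x ∷ l)))) ⟩
    Σ (tabulate {n = m} (λ x → boxSum (replicate n m) (λ l → G (toℕ x ∷ l))))
      ≡⟨ Σ-tabulate m (λ x → boxSum (replicate n m) (λ l → G (x ∷ l))) ⟩
    boxSum (replicate (suc n) m) G ∎
    where
    G' : Vec (Fin m) (suc n) → Carrier
    G' v = G (map toℕ (toList v))

  ∑-δ : ∀ B s (Ψ : ℕ → Carrier) → s < B → ∑[ x < B ] (⟦ does (x ≟ s) ⟧ * Ψ x) ≈ Ψ s
  ∑-δ (suc B) zero    Ψ _ = begin
    1# * Ψ 0 + ∑[ x < B ] (0# * Ψ (suc x))   ≈⟨ +-cong (*-identityˡ _) (trans (∑-cong B (λ x → zeroˡ _)) (∑-0 B)) ⟩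
    Ψ 0 + 0#                                 ≈⟨ +-identityʳ _ ⟩
    Ψ 0                                      ∎
  ∑-δ (suc B) (suc s) Ψ (s≤s s<B) = trans (+-cong (zeroˡ _) (∑-δ B s (λ x → Ψ (suc x)) s<B)) (+-identityˡ _)

  ⟦member-∷⟧ : ∀ x s S → All (s <_) S → ⟦ member x (s ∷ S) ⟧ ≈ ⟦ does (x ≟ s) ⟧ + ⟦ member x S ⟧
  ⟦member-∷⟧ x s S s<S with does (x ≟ s) | proof (x ≟ s)
  ... | true  | ofʸ ≡.refl rewrite member-lowerBound S s<S = sym (+-identityʳ _)
  ... | false | _          = sym (+-identityˡ _)

  ∑-⟦member⟧ : ∀ B S (Ψ : ℕ → Carrier) → Ascending S → All (_< B) S →
               ∑[ x < B ] (⟦ member x S ⟧ * Ψ x) ≈ ∑[ i < length S ] Ψ (nth S i)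
  ∑-⟦member⟧ B []      Ψ _           _          = trans (∑-cong B (λ x → zeroˡ _)) (∑-0 B)
  ∑-⟦member⟧ B (s ∷ S) Ψ (s<S ∷ asc) (s<B ∷ S<B) = begin
    ∑[ x < B ] (⟦ member x (s ∷ S) ⟧ * Ψ x)
      ≈⟨ ∑-cong B (λ x → trans (*-congʳ (⟦member-∷⟧ x s S s<S)) (distribʳ _ _ _)) ⟩
    ∑[ x < B ] (⟦ does (x ≟ s) ⟧ * Ψ x + ⟦ member x S ⟧ * Ψ x)
      ≈⟨ ∑-+ B _ _ ⟩
    ∑[ x < B ] (⟦ does (x ≟ s) ⟧ * Ψ x) + ∑[ x < B ] (⟦ member x S ⟧ * Ψ x)
      ≈⟨ +-cong (∑-δ B s Ψ s<B) (∑-⟦member⟧ B S Ψ asc S<B) ⟩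
    Ψ s + ∑[ i < length S ] Ψ (nth S i) ∎

  boxSum-permutations : ∀ m B S (Φ : List ℕ → Carrier) → Ascending S → All (_< B) S → length S ≡ m →
    boxSum (replicate m B) (λ σ → ⟦ distinct σ ∧ (σ ⊆ᵇ S) ⟧ * Φ σ) ≈ boxSum (codeBounds m) (λ c → Φ (decode S c))
  boxSum-permutations zero    B [] Φ _   _   _   = *-identityˡ _
  boxSum-permutations (suc m) B S  Φ asc S<B len = begin
    ∑[ x < B ] boxSum (replicate m B) (λ σ → ⟦ distinct (x ∷ σ) ∧ ((x ∷ σ) ⊆ᵇ S) ⟧ * Φ (x ∷ σ))
      ≈⟨ ∑-cong B (λ x → trans (boxSum-cong (replicate m B) (λ σ _ → first-letter x σ)) (boxSum-*ˡ (replicate m B) _ _)) ⟩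
    ∑[ x < B ] (⟦ member x S ⟧ * Ψ x)           ≈⟨ ∑-⟦member⟧ B S Ψ asc S<B ⟩
    ∑[ j < length S ] Ψ (nth S j)               ≡⟨ ≡.cong (λ n → ∑[ j < n ] Ψ (nth S j)) len ⟩
    ∑[ j < suc m ] Ψ (nth S j)                  ≈⟨ ∑-cong< (suc m) rest ⟩
    boxSum (codeBounds (suc m)) (λ c → Φ (decode S c)) ∎
    where
    Ψ : ℕ → Carrier
    Ψ x = boxSum (replicate m B) (λ σ → ⟦ distinct σ ∧ (σ ⊆ᵇ delete x S) ⟧ * Φ (x ∷ σ))
    first-letter : ∀ x σ → ⟦ distinct (x ∷ σ) ∧ ((x ∷ σ) ⊆ᵇ S) ⟧ * Φ (x ∷ σ) ≈
                           ⟦ member x S ⟧ * (⟦ distinct σ ∧ (σ ⊆ᵇ delete x S) ⟧ * Φ (x ∷ σ))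
    first-letter x σ =
      trans (*-congʳ (trans (reflexive (≡.cong ⟦_⟧ (distinct-⊆ᵇ-∷ x σ S asc))) (⟦∧⟧ (member x S) (distinct σ ∧ (σ ⊆ᵇ delete x S)))))
            (*-assoc _ _ _)
    rest : ∀ j → j < suc m → Ψ (nth S j) ≈ boxSum (codeBounds m) (λ c → Φ (nth S j ∷ decode (delete (nth S j) S) c))
    rest j j<m = boxSum-permutations m B (delete (nth S j) S) (λ σ → Φ (nth S j ∷ σ)) (AllPairs-delete _ asc) (All-delete _ S<B)
                                     (length-delete-nth S len j<m)

  -- Letter–colour words

  letterChains : ∀ x y j m → codeSum x y (shiftBounds m (downFrom j)) (λ l → ⟦ chainFrom 0 l ⟧) ≈ pow y (j C 2) * gauss x y j m
  letterChains x y j m = begin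
    codeSum x y (shiftBounds m (downFrom j)) (λ l → ⟦ chainFrom 0 l ⟧)
      ≈⟨ chainSum-eval x y (downFrom j) 0 m m (EndsInZero-downFrom j) ≡.refl ⟩
    pow x (length (downFrom j) ℕ.* 0) * pow y (sum (downFrom j)) * gauss x y (length (downFrom j)) m
      ≡⟨ ≡.cong₂ (λ a b → pow x (a ℕ.* 0) * pow y b * gauss x y a m) (length-applyDownFrom (λ i → i) j) (sum-downFrom j) ⟩
    pow x (j ℕ.* 0) * pow y (j C 2) * gauss x y j m
      ≈⟨ *-congʳ (trans (*-congʳ (reflexive (≡.cong (pow x) (ℕ.*-zeroʳ j)))) (*-identityˡ _)) ⟩
    pow y (j C 2) * gauss x y j m ∎

  colourChains : ∀ x j k → codeSum x 1# (replicate j (suc k)) (λ l → ⟦ chainFrom 0 l ⟧) ≈ gauss x 1# j k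
  colourChains x j k = begin
    codeSum x 1# (replicate j (suc k)) (λ l → ⟦ chainFrom 0 l ⟧)
      ≡⟨ ≡.cong (λ bs → codeSum x 1# bs (λ l → ⟦ chainFrom 0 l ⟧)) (≡.sym (map-replicate (λ e → suc (e ℕ.+ k)) j 0)) ⟩
    codeSum x 1# (shiftBounds k (replicate j 0)) (λ l → ⟦ chainFrom 0 l ⟧)
      ≈⟨ chainSum-eval x 1# (replicate j 0) 0 k k (EndsInZero-replicate j) ≡.refl ⟩
    pow x (length (replicate j 0) ℕ.* 0) * pow 1# (sum (replicate j 0)) * gauss x 1# (length (replicate j 0)) k
      ≡⟨ ≡.cong (λ a → pow x (a ℕ.* 0) * pow 1# (sum (replicate j 0)) * gauss x 1# a k) (length-replicate j) ⟩
    pow x (j ℕ.* 0) * pow 1# (sum (replicate j 0)) * gauss x 1# j k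
      ≈⟨ *-congʳ (*-cong (reflexive (≡.cong (pow x) (ℕ.*-zeroʳ j))) (pow-1# (sum (replicate j 0)))) ⟩
    1# * 1# * gauss x 1# j k
      ≈⟨ trans (*-congʳ (*-identityʳ _)) (*-identityˡ _) ⟩
    gauss x 1# j k ∎

  module ColouredWords (k : ℕ) (p q r : Carrier) where

    letterWeight : ℕ → ℕ → Carrier
    letterWeight b c = pow q c * pow p (b ∸ 1 ∸ c)

    -- The factor 1^(k-1-w) only serves to match the weights of codeSum r 1#.
    colourWeight : ℕ → Carrier
    colourWeight w = pow r w * pow 1# (k ∸ 1 ∸ w)

    pairSum : List ℕ → (List (ℕ × ℕ) → Carrier) → Carrier
    pairSum []       f = f []
    pairSum (b ∷ bs) f = ∑[ c < b ] ∑[ w < k ] ((letterWeight b c * colourWeight w) * pairSum bs (λ l → f ((c , w) ∷ l)))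

    pairSum-cong : ∀ bs {f g : List (ℕ × ℕ) → Carrier} → (∀ l → length l ≡ length bs → f l ≈ g l) → pairSum bs f ≈ pairSum bs g
    pairSum-cong []       f≈g = f≈g [] ≡.refl
    pairSum-cong (b ∷ bs) f≈g = ∑-cong b (λ c → ∑-cong k (λ w → *-congˡ (pairSum-cong bs (λ l len → f≈g _ (≡.cong suc len)))))

    pairSum-*ˡ : ∀ bs a (f : List (ℕ × ℕ) → Carrier) → pairSum bs (λ l → a * f l) ≈ a * pairSum bs f
    pairSum-*ˡ []       a f = refl
    pairSum-*ˡ (b ∷ bs) a f =
      trans (∑-cong b (λ c → trans (∑-cong k (λ w → trans (*-congˡ (pairSum-*ˡ bs a _)) (x∙yz≈y∙xz _ a _))) (∑-*ˡ k a _))) (∑-*ˡ b a _)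

    pairSum-*ʳ : ∀ bs a (f : List (ℕ × ℕ) → Carrier) → pairSum bs (λ l → f l * a) ≈ pairSum bs f * a
    pairSum-*ʳ bs a f = trans (pairSum-cong bs (λ l _ → *-comm (f l) a)) (trans (pairSum-*ˡ bs a f) (*-comm a _))

    pairSum-0 : ∀ bs → pairSum bs (λ _ → 0#) ≈ 0#
    pairSum-0 bs = trans (pairSum-cong bs (λ _ _ → sym (zeroˡ 0#))) (trans (pairSum-*ˡ bs 0# (λ _ → 0#)) (zeroˡ _))

    pairSum-+ : ∀ bs (f g : List (ℕ × ℕ) → Carrier) → pairSum bs (λ l → f l + g l) ≈ pairSum bs f + pairSum bs g
    pairSum-+ []       f g = refl
    pairSum-+ (b ∷ bs) f g =
      trans (∑-cong b (λ c → trans (∑-cong k (λ w → trans (*-congˡ (pairSum-+ bs _ _)) (distribˡ _ _ _))) (∑-+ k _ _))) (∑-+ b _ _)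

    pairSum-∑ : ∀ bs n (F : ℕ → List (ℕ × ℕ) → Carrier) → pairSum bs (λ l → ∑[ j < n ] F j l) ≈ ∑[ j < n ] pairSum bs (F j)
    pairSum-∑ bs zero    F = pairSum-0 bs
    pairSum-∑ bs (suc n) F = trans (pairSum-+ bs (F 0) _) (+-congˡ (pairSum-∑ bs n (λ j → F (suc j))))

    pairSum-++ : ∀ bs bs' (f : List (ℕ × ℕ) → Carrier) → pairSum (bs ++ bs') f ≈ pairSum bs (λ l → pairSum bs' (λ l' → f (l ++ l')))
    pairSum-++ []       bs' f = refl
    pairSum-++ (b ∷ bs) bs' f = ∑-cong b (λ c → ∑-cong k (λ w → *-congˡ (pairSum-++ bs bs' _)))

    pairSum-product : ∀ bs (g h : List ℕ → Carrier) →
      pairSum bs (λ l → g (map proj₁ l) * h (map proj₂ l)) ≈ codeSum q p bs g * codeSum r 1# (replicate (length bs) k) h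
    pairSum-product []       g h = refl
    pairSum-product (b ∷ bs) g h = begin
      ∑[ c < b ] ∑[ w < k ] ((letterWeight b c * colourWeight w) * pairSum bs (λ l → g (c ∷ map proj₁ l) * h (w ∷ map proj₂ l)))
        ≈⟨ ∑-cong b (λ c → ∑-cong k (λ w → trans (*-congˡ (pairSum-product bs _ _)) (interchange _ _ _ _))) ⟩
      ∑[ c < b ] ∑[ w < k ] ((letterWeight b c * codeSum q p bs (λ l → g (c ∷ l))) * (colourWeight w * codeSum r 1# (replicate (length bs) k) (λ l → h (w ∷ l))))
        ≈⟨ ∑-*-∑ b k _ _ ⟨
      codeSum q p (b ∷ bs) g * codeSum r 1# (replicate (length (b ∷ bs)) k) h ∎

    runTerm : ℕ → List (ℕ × ℕ) → Carrier
    runTerm j l = ⟦ linked rise (take j l) ⟧ * ⟦ linked descent (drop j l) ⟧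

    noRiseSum : ℕ → Carrier
    noRiseSum m = pairSum (codeBounds m) (λ l → ⟦ linked descent l ⟧)

    -- Rises throughout the first j letters make them a pair of weakly increasing chains, independent of the rest.
    pairSum-runTerm : ∀ j m → pairSum (codeBounds (j ℕ.+ m)) (runTerm j) ≈
      (codeSum q p (shiftBounds m (downFrom j)) (λ l → ⟦ chainFrom 0 l ⟧) * codeSum r 1# (replicate j k) (λ l → ⟦ chainFrom 0 l ⟧)) * noRiseSum m
    pairSum-runTerm j m = begin
      pairSum (codeBounds (j ℕ.+ m)) (runTerm j)
        ≡⟨ ≡.cong (λ bs → pairSum bs (runTerm j)) (codeBounds-+ j m) ⟩
      pairSum (pre ++ codeBounds m) (runTerm j)
        ≈⟨ pairSum-++ pre (codeBounds m) (runTerm j) ⟩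
      pairSum pre (λ l → pairSum (codeBounds m) (λ l' → runTerm j (l ++ l')))
        ≈⟨ pairSum-cong pre (λ l len → trans (pairSum-cong (codeBounds m) (λ l' _ → split l l' (≡.trans len length-pre)))
                                              (pairSum-*ˡ (codeBounds m) _ _)) ⟩
      pairSum pre (λ l → ⟦ linked rise l ⟧ * noRiseSum m)
        ≈⟨ pairSum-*ʳ pre (noRiseSum m) _ ⟩
      pairSum pre (λ l → ⟦ linked rise l ⟧) * noRiseSum m
        ≈⟨ *-congʳ (pairSum-cong pre (λ l _ → trans (reflexive (≡.cong ⟦_⟧ (linked-rise l)))
                                                    (⟦∧⟧ (chainFrom 0 (map proj₁ l)) (chainFrom 0 (map proj₂ l))))) ⟩
      pairSum pre (λ l → ⟦ chainFrom 0 (map proj₁ l) ⟧ * ⟦ chainFrom 0 (map proj₂ l) ⟧) * noRiseSum m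
        ≈⟨ *-congʳ (pairSum-product pre (λ l → ⟦ chainFrom 0 l ⟧) (λ l → ⟦ chainFrom 0 l ⟧)) ⟩
      (codeSum q p pre (λ l → ⟦ chainFrom 0 l ⟧) * codeSum r 1# (replicate (length pre) k) (λ l → ⟦ chainFrom 0 l ⟧)) * noRiseSum m
        ≡⟨ ≡.cong (λ n → (codeSum q p pre (λ l → ⟦ chainFrom 0 l ⟧) * codeSum r 1# (replicate n k) (λ l → ⟦ chainFrom 0 l ⟧)) * noRiseSum m) length-pre ⟩
      (codeSum q p pre (λ l → ⟦ chainFrom 0 l ⟧) * codeSum r 1# (replicate j k) (λ l → ⟦ chainFrom 0 l ⟧)) * noRiseSum m ∎
      where
      pre = shiftBounds m (downFrom j)
      length-pre : length pre ≡ j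
      length-pre = ≡.trans (length-map _ (downFrom j)) (length-applyDownFrom (λ i → i) j)
      split : ∀ l l' → length l ≡ j → runTerm j (l ++ l') ≈ ⟦ linked rise l ⟧ * ⟦ linked descent l' ⟧
      split l l' ≡.refl = reflexive (≡.cong₂ (λ u v → ⟦ linked rise u ⟧ * ⟦ linked descent v ⟧) (take-length-++ l l') (drop-length-++ l l'))

    alternating-runTerm : ∀ n → ∑[ j < suc (suc n) ] (pow (- 1#) j * pairSum (codeBounds (suc n)) (runTerm j)) ≈ 0#
    alternating-runTerm n = begin
      ∑[ j < suc (suc n) ] (pow (- 1#) j * pairSum (codeBounds (suc n)) (runTerm j))
        ≈⟨ ∑-cong (suc (suc n)) (λ j → sym (pairSum-*ˡ (codeBounds (suc n)) (pow (- 1#) j) (runTerm j))) ⟩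
      ∑[ j < suc (suc n) ] pairSum (codeBounds (suc n)) (λ l → pow (- 1#) j * runTerm j l)
        ≈⟨ pairSum-∑ (codeBounds (suc n)) (suc (suc n)) (λ j l → pow (- 1#) j * runTerm j l) ⟨
      pairSum (codeBounds (suc n)) (λ l → ∑[ j < suc (suc n) ] (pow (- 1#) j * runTerm j l))
        ≈⟨ pairSum-cong (codeBounds (suc n)) (λ l len → vanish l (≡.trans len (length-codeBounds (suc n)))) ⟩
      pairSum (codeBounds (suc n)) (λ _ → 0#)
        ≈⟨ pairSum-0 (codeBounds (suc n)) ⟩
      0# ∎
      where
      vanish : ∀ l → length l ≡ suc n → ∑[ j < suc (suc n) ] (pow (- 1#) j * runTerm j l) ≈ 0#
      vanish (u ∷ l) ≡.refl = alternatingRuns-∷ rise u l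

    codeWeight : List ℕ → List ℕ → Carrier
    codeWeight (b ∷ bs) (c ∷ cs) = letterWeight b c * codeWeight bs cs
    codeWeight _        _        = 1#

    colourWeights : List ℕ → Carrier
    colourWeights []       = 1#
    colourWeights (w ∷ ws) = colourWeight w * colourWeights ws

    pairSum-boxSum : ∀ bs (f : List (ℕ × ℕ) → Carrier) →
      pairSum bs f ≈ boxSum bs (λ c → boxSum (replicate (length bs) k) (λ w → (codeWeight bs c * colourWeights w) * f (zip c w)))
    pairSum-boxSum []       f = sym (trans (*-congʳ (*-identityʳ _)) (*-identityˡ _))
    pairSum-boxSum (b ∷ bs) f = ∑-cong b (λ c → begin
      ∑[ w < k ] ((letterWeight b c * colourWeight w) * pairSum bs (λ l → f ((c , w) ∷ l)))
        ≈⟨ ∑-cong k (λ w → *-congˡ (pairSum-boxSum bs _)) ⟩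
      ∑[ w < k ] ((letterWeight b c * colourWeight w) * boxSum bs (λ c' → boxSum ks (λ w' → (codeWeight bs c' * colourWeights w') * f ((c , w) ∷ zip c' w'))))
        ≈⟨ ∑-cong k (λ w → trans (sym (boxSum-*ˡ bs _ _)) (boxSum-cong bs (λ c' _ → trans (sym (boxSum-*ˡ ks _ _))
             (boxSum-cong ks (λ w' _ → regroup _ _ _ _ _))))) ⟩
      ∑[ w < k ] boxSum bs (λ c' → boxSum ks (λ w' → ((letterWeight b c * codeWeight bs c') * (colourWeight w * colourWeights w')) * f ((c , w) ∷ zip c' w')))
        ≈⟨ boxSum-∑ bs k _ ⟨
      boxSum bs (λ c' → ∑[ w < k ] boxSum ks (λ w' → ((letterWeight b c * codeWeight bs c') * (colourWeight w * colourWeights w')) * f ((c , w) ∷ zip c' w'))) ∎)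
      where
      ks = replicate (length bs) k
      regroup : ∀ a b d e f → (a * b) * ((d * e) * f) ≈ ((a * d) * (b * e)) * f
      regroup = solve 5 (λ a b d e f → (a :* b) :* ((d :* e) :* f) := ((a :* d) :* (b :* e)) :* f) refl

    codeWeight-pow : ∀ bs cs → Pointwise _>_ bs cs → pow q (sum cs) * pow p (coinvCode bs cs) ≈ codeWeight bs cs
    codeWeight-pow []       []       []          = *-identityʳ _
    codeWeight-pow (b ∷ bs) (c ∷ cs) (_ ∷ c<bs) = begin
      pow q (c ℕ.+ sum cs) * pow p ((b ∸ 1 ∸ c) ℕ.+ coinvCode bs cs)                   ≈⟨ *-cong (pow-+ q c _) (pow-+ p (b ∸ 1 ∸ c) _) ⟩
      (pow q c * pow q (sum cs)) * (pow p (b ∸ 1 ∸ c) * pow p (coinvCode bs cs))       ≈⟨ interchange _ _ _ _ ⟩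
      letterWeight b c * (pow q (sum cs) * pow p (coinvCode bs cs))                    ≈⟨ *-congˡ (codeWeight-pow bs cs c<bs) ⟩
      letterWeight b c * codeWeight bs cs                                              ∎

    colourWeights-pow : ∀ ws → pow r (sum ws) ≈ colourWeights ws
    colourWeights-pow []       = refl
    colourWeights-pow (w ∷ ws) = trans (pow-+ r w _) (*-cong (sym (trans (*-congˡ (pow-1# (k ∸ 1 ∸ w))) (*-identityʳ _))) (colourWeights-pow ws))

    risSummand : List ℕ → List ℕ → Carrier
    risSummand σ w = if ⌊ ris (zip σ w) ℕ.≟ 0 ⌋ then pow q (inv σ) * pow p (coinv σ) * pow r (norm w) else 0#

    risSummand-decode : ∀ m S cs ws → Ascending S → length S ≡ m → IsCode m cs →
      risSummand (decode S cs) ws ≈ (codeWeight (codeBounds m) cs * colourWeights ws) * ⟦ linked descent (zip cs ws) ⟧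
    risSummand-decode m S cs ws asc len code = begin
      risSummand σ ws
        ≈⟨ if≈⟦⟧* _ _ ⟩
      ⟦ ⌊ ris (zip σ ws) ℕ.≟ 0 ⌋ ⟧ * (pow q (inv σ) * pow p (coinv σ) * pow r (norm ws))
        ≈⟨ *-cong (reflexive (≡.cong ⟦_⟧ (≡.trans (isYes≗does (ris (zip σ ws) ℕ.≟ 0)) (ris-decode m S cs ws asc len code))))
                  (*-cong (*-cong (reflexive (≡.cong (pow q) (inv-decode m S cs asc len code)))
                                  (reflexive (≡.cong (pow p) (coinv-decode m S cs asc len code))))
                          (colourWeights-pow ws)) ⟩
      ⟦ linked descent (zip cs ws) ⟧ * (pow q (sum cs) * pow p (coinvCode (codeBounds m) cs) * colourWeights ws)
        ≈⟨ *-comm _ _ ⟩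
      (pow q (sum cs) * pow p (coinvCode (codeBounds m) cs) * colourWeights ws) * ⟦ linked descent (zip cs ws) ⟧
        ≈⟨ *-congʳ (*-congʳ (codeWeight-pow (codeBounds m) cs code)) ⟩
      (codeWeight (codeBounds m) cs * colourWeights ws) * ⟦ linked descent (zip cs ws) ⟧ ∎
      where
      σ = decode S cs
      if≈⟦⟧* : ∀ b (X : Carrier) → (if b then X else 0#) ≈ ⟦ b ⟧ * X
      if≈⟦⟧* true  X = sym (*-identityˡ _)
      if≈⟦⟧* false X = sym (zeroˡ _)

    risZeroSum≈noRiseSum : ∀ m → risZeroSum k p q r m ≈ noRiseSum m
    risZeroSum≈noRiseSum m = begin
      risZeroSum k p q r m
        ≈⟨ Σ-concatMap (λ σ → map (λ w → risSummand (toℕs σ) (toℕs w)) (words k m)) (perms m) ⟩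
      Σ (map (λ σ → Σ (map (λ w → risSummand (toℕs σ) (toℕs w)) (words k m))) (perms m))
        ≈⟨ Σ-filter (λ σ → distinct (toℕs σ)) (λ σ → Σ (map (λ w → risSummand (toℕs σ) (toℕs w)) (words k m))) (words m m) ⟩
      Σ (map (λ σ → ⟦ distinct (toℕs σ) ⟧ * Σ (map (λ w → risSummand (toℕs σ) (toℕs w)) (words k m))) (words m m))
        ≈⟨ Σ-map-cong (words m m) (λ σ → *-congˡ (Σ-words k m (risSummand (toℕs σ)))) ⟩
      Σ (map (λ σ → ⟦ distinct (toℕs σ) ⟧ * boxSum ks (risSummand (toℕs σ))) (words m m))
        ≈⟨ Σ-words m m (λ σ → ⟦ distinct σ ⟧ * boxSum ks (risSummand σ)) ⟩
      boxSum (replicate m m) (λ σ → ⟦ distinct σ ⟧ * boxSum ks (risSummand σ))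
        ≈⟨ boxSum-cong (replicate m m) (λ σ σ<m → *-congʳ (reflexive (≡.cong ⟦_⟧ (≡.sym (≡.trans (≡.cong (distinct σ ∧_) (⊆ᵇ-interval m m σ σ<m))
                                                                                              (∧-identityʳ _)))))) ⟩
      boxSum (replicate m m) (λ σ → ⟦ distinct σ ∧ (σ ⊆ᵇ interval 0 m) ⟧ * boxSum ks (risSummand σ))
        ≈⟨ boxSum-permutations m m (interval 0 m) (λ σ → boxSum ks (risSummand σ)) (Ascending-interval 0 m) (interval-< 0 m) (length-interval 0 m) ⟩
      boxSum (codeBounds m) (λ c → boxSum ks (risSummand (decode (interval 0 m) c)))
        ≈⟨ boxSum-cong (codeBounds m) (λ c code → boxSum-cong ks (λ w _ →
             risSummand-decode m (interval 0 m) c w (Ascending-interval 0 m) (length-interval 0 m) code)) ⟩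
      boxSum (codeBounds m) (λ c → boxSum ks (λ w → (codeWeight (codeBounds m) c * colourWeights w) * ⟦ linked descent (zip c w) ⟧))
        ≡⟨ ≡.cong (λ n → boxSum (codeBounds m) (λ c → boxSum (replicate n k) (λ w → (codeWeight (codeBounds m) c * colourWeights w) * ⟦ linked descent (zip c w) ⟧)))
                  (≡.sym (length-codeBounds m)) ⟩
      boxSum (codeBounds m) (λ c → boxSum (replicate (length (codeBounds m)) k) (λ w → (codeWeight (codeBounds m) c * colourWeights w) * ⟦ linked descent (zip c w) ⟧))
        ≈⟨ pairSum-boxSum (codeBounds m) (λ l → ⟦ linked descent l ⟧) ⟨
      noRiseSum m ∎
      where
      ks = replicate m k
      toℕs : ∀ {n b} → Vec (Fin b) n → List ℕ
      toℕs v = map toℕ (toList v)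

  rInt≈pqInt : ∀ x n → rInt x n ≈ pqInt 1# x n
  rInt≈pqInt x n = begin
    rInt x n                                      ≡⟨ Σ-map-applyUpTo (pow x) (λ i → i) n ⟩
    ∑[ i < n ] pow x i                            ≈⟨ ∑-cong n (λ i → sym (trans (*-congʳ (pow-1# (n ∸ 1 ∸ i))) (*-identityˡ _))) ⟩
    ∑[ i < n ] (pow 1# (n ∸ 1 ∸ i) * pow x i)     ≡⟨ pqInt-∑ 1# x n ⟨
    pqInt 1# x n                                  ∎

  rFact≈pqFact : ∀ x n → rFact x n ≈ pqFact 1# x n
  rFact≈pqFact x zero    = refl
  rFact≈pqFact x (suc n) = *-cong (rInt≈pqInt x (suc n)) (rFact≈pqFact x n)

  module _ (x : Carrier) (iF : ℕ → Carrier) (iF-inverse : ∀ n → iF n * rFact x n ≈ 1#) where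

    rBinom≈gauss : ∀ j k → rBinom x iF (j ℕ.+ k) j ≈ gauss x 1# j k
    rBinom≈gauss j k = begin
      rFact x (j ℕ.+ k) * (iF j * iF (j ℕ.+ k ∸ j))        ≡⟨ ≡.cong (λ n → rFact x (j ℕ.+ k) * (iF j * iF n)) (ℕ.m+n∸m≡n j k) ⟩
      rFact x (j ℕ.+ k) * (iF j * iF k)                    ≈⟨ *-congʳ (trans (rFact≈pqFact x (j ℕ.+ k)) (sym (gauss-pqFact x 1# j k))) ⟩
      gauss x 1# j k * pqFact 1# x j * pqFact 1# x k * (iF j * iF k)
                                                           ≈⟨ *-congʳ (*-cong (*-congˡ (sym (rFact≈pqFact x j))) (sym (rFact≈pqFact x k))) ⟩
      gauss x 1# j k * rFact x j * rFact x k * (iF j * iF k)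
        ≈⟨ solve 5 (λ G F₁ F₂ I₁ I₂ → G :* F₁ :* F₂ :* (I₁ :* I₂) := G :* (I₁ :* F₁) :* (I₂ :* F₂)) refl _ _ _ _ _ ⟩
      gauss x 1# j k * (iF j * rFact x j) * (iF k * rFact x k)   ≈⟨ *-cong (*-congˡ (iF-inverse j)) (iF-inverse k) ⟩
      gauss x 1# j k * 1# * 1#                             ≈⟨ trans (*-identityʳ _) (*-identityʳ _) ⟩
      gauss x 1# j k                                       ∎

  module _ (x y : Carrier) (iF : ℕ → Carrier) (iF-inverse : ∀ n → iF n * pqFact x y n ≈ 1#) where

    inverse-pqFact-+ : ∀ j m → iF m * iF j ≈ iF (j ℕ.+ m) * gauss y x j m
    inverse-pqFact-+ j m = sym (begin
      iF (j ℕ.+ m) * gauss y x j m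
        ≈⟨ sym (trans (*-cong (*-congˡ (iF-inverse j)) (iF-inverse m)) (trans (*-identityʳ _) (*-identityʳ _))) ⟩
      iF (j ℕ.+ m) * gauss y x j m * (iF j * pqFact x y j) * (iF m * pqFact x y m)
        ≈⟨ solve 6 (λ I G I₁ F₁ I₂ F₂ → I :* G :* (I₁ :* F₁) :* (I₂ :* F₂) := (I :* (G :* F₁ :* F₂)) :* (I₂ :* I₁)) refl _ _ _ _ _ _ ⟩
      (iF (j ℕ.+ m) * (gauss y x j m * pqFact x y j * pqFact x y m)) * (iF m * iF j)
        ≈⟨ *-congʳ (*-congˡ (gauss-pqFact y x j m)) ⟩
      (iF (j ℕ.+ m) * pqFact x y (j ℕ.+ m)) * (iF m * iF j)
        ≈⟨ trans (*-congʳ (iF-inverse _)) (*-identityˡ _) ⟩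
      iF m * iF j ∎)

  module _ (k : ℕ) (p q r : Carrier)
           (ipq : ℕ → Carrier) (ipq-inverse : ∀ n → ipq n * pqFact p q n ≈ 1#)
           (ir : ℕ → Carrier) (ir-inverse : ∀ n → ir n * rFact r n ≈ 1#) where

    open ColouredWords (suc k) p q r

    private
      lhs den : ℕ → Carrier
      lhs = lhsCoeff (suc k) p q r ipq
      den = denCoeff (suc k) p q r ipq ir

    ipq-0 : ipq 0 ≈ 1#
    ipq-0 = trans (sym (*-identityʳ _)) (ipq-inverse 0)

    denCoeff≈ : ∀ j → den j ≈ pow p (j C 2) * pow (- 1#) j * ipq j * gauss r 1# j k
    denCoeff≈ zero    = sym (trans (*-identityʳ _) (trans (*-congʳ (*-identityʳ 1#)) (trans (*-identityˡ _) ipq-0)))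
    denCoeff≈ (suc j) = *-congˡ (trans (reflexive (≡.cong (λ n → rBinom r ir n (suc j)) (≡.cong (_∸ 1) (ℕ.+-suc (suc j) k))))
                                       (rBinom≈gauss r ir ir-inverse (suc j) k))

    -- The j-th term of the convolution at N, reversed as by ∑-reverse.
    lhs*den≈runTerm : ∀ N j → j ≤ N → lhs (N ∸ j) * den (N ∸ (N ∸ j)) ≈ ipq N * (pow (- 1#) j * pairSum (codeBounds N) (runTerm j))
    lhs*den≈runTerm N j j≤N = begin
      (ipq m * risZeroSum (suc k) p q r m) * den (N ∸ m)
        ≡⟨ ≡.cong (λ i → (ipq m * risZeroSum (suc k) p q r m) * den i) (ℕ.m∸[m∸n]≡n j≤N) ⟩
      (ipq m * risZeroSum (suc k) p q r m) * den j
        ≈⟨ *-cong (*-congˡ (risZeroSum≈noRiseSum m)) (denCoeff≈ j) ⟩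
      (ipq m * A) * (pow p (j C 2) * pow (- 1#) j * ipq j * Gr)
        ≈⟨ solve 6 (λ I₁ A P S I₂ G → (I₁ :* A) :* (P :* S :* I₂ :* G) := (I₁ :* I₂) :* (P :* S :* G :* A)) refl _ _ _ _ _ _ ⟩
      (ipq m * ipq j) * (pow p (j C 2) * pow (- 1#) j * Gr * A)
        ≈⟨ *-congʳ (inverse-pqFact-+ p q ipq ipq-inverse j m) ⟩
      (ipq (j ℕ.+ m) * gauss q p j m) * (pow p (j C 2) * pow (- 1#) j * Gr * A)
        ≈⟨ solve 6 (λ I G P S H A → (I :* G) :* (P :* S :* H :* A) := I :* (S :* ((P :* G :* H) :* A))) refl _ _ _ _ _ _ ⟩
      ipq (j ℕ.+ m) * (pow (- 1#) j * ((pow p (j C 2) * gauss q p j m * Gr) * A))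
        ≈⟨ *-congˡ (*-congˡ (sym (trans (pairSum-runTerm j m) (*-congʳ (*-cong (letterChains q p j m) (colourChains r j k)))))) ⟩
      ipq (j ℕ.+ m) * (pow (- 1#) j * pairSum (codeBounds (j ℕ.+ m)) (runTerm j))
        ≡⟨ ≡.cong (λ n → ipq n * (pow (- 1#) j * pairSum (codeBounds n) (runTerm j))) (ℕ.m+[n∸m]≡n j≤N) ⟩
      ipq N * (pow (- 1#) j * pairSum (codeBounds N) (runTerm j)) ∎
      where
      m  = N ∸ j
      A  = noRiseSum m
      Gr = gauss r 1# j k

    conv-lhs-den : ∀ N → conv lhs den N ≈ one N
    conv-lhs-den zero = begin
      (ipq 0 * risZeroSum (suc k) p q r 0) * 1# + 0#   ≈⟨ trans (+-identityʳ _) (*-identityʳ _) ⟩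
      ipq 0 * risZeroSum (suc k) p q r 0               ≈⟨ *-cong ipq-0 (risZeroSum≈noRiseSum 0) ⟩
      1# * 1#                                          ≈⟨ *-identityʳ _ ⟩
      1#                                               ∎
    conv-lhs-den (suc n) = begin
      conv lhs den N                                                          ≡⟨ Σ-map-applyUpTo (λ m → lhs m * den (N ∸ m)) (λ i → i) (suc N) ⟩
      ∑[ m < suc N ] (lhs m * den (N ∸ m))                                    ≈⟨ ∑-reverse (suc N) (λ m → lhs m * den (N ∸ m)) ⟩
      ∑[ j < suc N ] (lhs (N ∸ j) * den (N ∸ (N ∸ j)))                        ≈⟨ ∑-cong< (suc N) (λ j j<N → lhs*den≈runTerm N j (ℕ.≤-pred j<N)) ⟩
      ∑[ j < suc N ] (ipq N * (pow (- 1#) j * pairSum (codeBounds N) (runTerm j)))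
                                                                              ≈⟨ ∑-*ˡ (suc N) (ipq N) (λ j → pow (- 1#) j * pairSum (codeBounds N) (runTerm j)) ⟩
      ipq N * ∑[ j < suc N ] (pow (- 1#) j * pairSum (codeBounds N) (runTerm j))
                                                                              ≈⟨ *-congˡ (alternating-runTerm n) ⟩
      ipq N * 0#                                                              ≈⟨ zeroʳ _ ⟩
      0#                                                                      ∎
      where
      N = suc n

corollary11 : {c ℓ : Level} (R : CommutativeRing c ℓ) →
  let open CommutativeRing R
      open Gen R
  in (k : ℕ) → 2 ≤ k → (p q r : Carrier) →
     (ipq : ℕ → Carrier) → (∀ n → ipq n * pqFact p q n ≈ 1#) →
     (ir : ℕ → Carrier) → (∀ n → ir n * rFact r n ≈ 1#) →
     ∀ N → conv (lhsCoeff k p q r ipq) (denCoeff k p q r ipq ir) N ≈ one N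
corollary11 R (suc k) _ p q r ipq ipq-inverse ir ir-inverse = conv-lhs-den R k p q r ipq ipq-inverse ir ir-inverse
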